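{- $\mathcal D$ is a model of the $\partial\lambda$-calculus with tests: for all sums of expressions $\mathbb A,\mathbb B$ and every repetition-free list $\vec x$ of variables containing the free variables of $\mathbb A$, if $\mathbb A\twoheadrightarrow\mathbb B$ then $\llbracket\mathbb A\rrbracket_{\vec x}=\llbracket\mathbb B\rrbracket_{\vec x}$.
   Context: Syntax of the $\partial\lambda$-calculus with tests. Terms $M,N,L$, bags $P$, tests $V,W$: $M::=x\mid\lambda x.M\mid MP\mid\bar\tau(V)$, $P::=[L_1,\dots,L_k,\mathbb N^{!}]$, $V::=\tau[L_1,\dots,L_k]$ ($k\ge0$), where $\mathbb N$ is a finite sum of terms; up to $\alpha$-equivalence. Sums of each sort are finite formal sums with idempotent addition, $0$ the empty sum. Bag union: $[L_1,\dots,L_k,\mathbb N^!]\uplus[L'_1,\dots,L'_h,\mathbb M^!]=[L_1,\dots,L_k,L'_1,\dots,L'_h,(\mathbb N+\mathbb M)^!]$; $[L_1,\dots,L_k]$ stands for $[L_1,\dots,L_k,0^!]$. $\varepsilon:=\tau[\,]$, $V\mid W$ multiset union of tests. Constructors are extended to sums multilinearly (constructors applied to $0$ give $0$), except that the promoted component is not distributed: $[\vec L,(\mathbb N+\mathbb M)^!]\ne[\vec L,\mathbb N^!]+[\vec L,\mathbb M^!]$. $A\{\mathbb N/x\}$ replaces each free occurrence of $x$ by $\mathbb N$. Linear substitution: $x\langle N/x\rangle=N$, $y\langle N/x\rangle=0$ ($y\ne x$), $(\lambda y.M)\langle N/x\rangle=\lambda y.M\langle N/x\rangle$, $(MP)\langle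 N/x\rangle=M\langle N/x\rangle P+M(P\langle N/x\rangle)$, $\bar\tau(V)\langle N/x\rangle=\bar\tau(V\langle N/x\rangle)$, $\tau[L_1,\dots,L_k]\langle N/x\rangle=\sum_i\tau[L_1,\dots,L_i\langle N/x\rangle,\dots,L_k]$, $[L_1,\dots,L_k,\mathbb N^!]\langle N/x\rangle=\sum_i[L_1,\dots,L_i\langle N/x\rangle,\dots,L_k,\mathbb N^!]+[L_1,\dots,L_k,\mathbb N\langle N/x\rangle,\mathbb N^!]$, bilinear on sums; $A\langle[L_1,\dots,L_k]/x\rangle:=A\langle L_1/x\rangle\cdots\langle L_k/x\rangle$. Reduction rules: $(\lambda x.M)[L_1,\dots,L_k,\mathbb N^!]\to M\langle[L_1,\dots,L_k]/x\rangle\{\mathbb N/x\}$; $\bar\tau(V)[L_1,\dots,L_k,\mathbb N^!]\to\bar\tau(V)$ if $k=0$, $\to0$ otherwise; $\tau[\lambda x.M]\mid V\to\tau[M\{0/x\}]\mid V$; $\tau[\bar\tau(V)]\mid W\to V\mid W$. $\to$ is their closure under all syntactic positions (including inside a promoted sum: $[(M+\mathbb N)^!]\uplus P\to[(\mathbb M+\mathbb N)^!]\uplus P$ when $M\to\mathbb M$) and under sums; $\twoheadrightarrow$ is the reflexive-transitive closure. The model $\mathcal D$. $\mathcal M_f(S)$ = finite multisets over $S$; $D_0=\emptyset$, $D_{n+1}$ = $\mathbb N$-indexed sequences $(a_1,a_2,\dots)$ of elements of $\mathcal M_f(D_n)$ with all but finitely many empty; $\mathcal D=\bigcup_nD_n$;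 $a::(a_1,a_2,\dots):=(a,a_1,a_2,\dots)$; $*:=([\,],[\,],\dots)$; $\uplus$ on tuples componentwise. For a repetition-free list $\vec x=x_1,\dots,x_n$ containing the free variables: $\llbracket x_i\rrbracket_{\vec x}=\{(([\,],\dots,[\alpha],\dots,[\,]),\alpha):\alpha\in\mathcal D\}$; $\llbracket\lambda y.M\rrbracket_{\vec x}=\{(\vec a,b::\alpha):((\vec a,b),\alpha)\in\llbracket M\rrbracket_{\vec x,y}\}$; $\llbracket MP\rrbracket_{\vec x}=\{(\vec a_1\uplus\vec a_2,\alpha):\exists b\,(\vec a_1,b::\alpha)\in\llbracket M\rrbracket_{\vec x},(\vec a_2,b)\in\llbracket P\rrbracket_{\vec x}\}$; $\llbracket\bar\tau(V)\rrbracket_{\vec x}=\{(\vec a,*):\vec a\in\llbracket V\rrbracket_{\vec x}\}$; $\llbracket[L_1,\dots,L_k,\mathbb N^!]\rrbracket_{\vec x}=\{(\biguplus_{r=1}^{k+m}\vec a_r,[\beta_1,\dots,\beta_{k+m}]):m\ge0,(\vec a_j,\beta_j)\in\llbracket L_j\rrbracket_{\vec x}\ (j\le k),(\vec a_i,\beta_i)\in\llbracket\mathbb N\rrbracket_{\vec x}\ (k<i\le k+m)\}$; $\llbracket\tau[L_1,\dots,L_k]\rrbracket_{\vec x}=\{\biguplus_i\vec a_i:(\vec a_i,*)\in\llbracket L_i\rrbracket_{\vec x}\}$; sums as unions. -}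

module Defs where

open import Data.Nat using (ℕ; zero; suc)
open import Data.Fin using (Fin; zero; suc; _≟_)
open import Data.List using (List; []; _∷_; _++_; map; concatMap; _∷ʳ_)
open import Data.Vec using (Vec; replicate; zipWith; _[_]≔_; _∷_)
open import Data.Vec.Relation.Binary.Pointwise.Inductive using (Pointwise)
open import Data.Product using (Σ; ∃; ∃₂; _×_; _,_)
open import Data.Sum using (_⊎_)
open import Data.Empty using (⊥)
open import Data.Unit using (⊤; tt)
open import Data.Bool using (if_then_else_)
open import Relation.Nullary using (does)
open import Relation.Binary.PropositionalEquality using (_≡_)
open import Data.List.Membership.Propositional using (_∈_)
open import Relation.Binary.Construct.Closure.ReflexiveTransitive using (Star)

-- Syntax of the ∂λ-calculus with tests (well-scoped de Bruijn indices,
-- so terms are taken up to α-equivalence).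
--   tm : terms  M ::= x | λx.M | M P | τ̄(V)
--   bg : bags   P ::= [L₁,…,L_k, 𝐍^!]   (linear part, promoted sum 𝐍)
--   ts : tests  V ::= τ[L₁,…,L_k]
-- Sums are finite formal sums, represented by lists; the idempotence /
-- commutativity of +, and the multiset nature of bags and tests, are
-- handled by the structural equivalence _~_ below.

data Sort : Set where
  tm bg ts : Sort

data Exp : ℕ → Sort → Set where
  var  : ∀ {n} → Fin n → Exp n tm
  lam  : ∀ {n} → Exp (suc n) tm → Exp n tm
  app  : ∀ {n} → Exp n tm → Exp n bg → Exp n tm
  tbar : ∀ {n} → Exp n ts → Exp n tm
  bag  : ∀ {n} → List (Exp n tm) → List (Exp n tm) → Exp n bg
  test : ∀ {n} → List (Exp n tm) → Exp n ts

Sum : ℕ → Sort → Set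
Sum n s = List (Exp n s)

ext : ∀ {n m} → (Fin n → Fin m) → Fin (suc n) → Fin (suc m)
ext f zero    = zero
ext f (suc i) = suc (f i)

mutual
  ren : ∀ {n m s} → (Fin n → Fin m) → Exp n s → Exp m s
  ren f (var i)    = var (f i)
  ren f (lam M)    = lam (ren (ext f) M)
  ren f (app M P)  = app (ren f M) (ren f P)
  ren f (tbar V)   = tbar (ren f V)
  ren f (bag Ls N) = bag (renL f Ls) (renL f N)
  ren f (test Ls)  = test (renL f Ls)

  renL : ∀ {n m} → (Fin n → Fin m) → List (Exp n tm) → List (Exp m tm)
  renL f []       = []
  renL f (L ∷ Ls) = ren f L ∷ renL f Ls

weaken : ∀ {n s} → Exp n s → Exp (suc n) s
weaken = ren suc

-- Substitution A{𝐍/x} of sums for variables, extended multilinearly,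
-- except in promoted positions (where the substituted sum is kept).

exts : ∀ {n m} → (Fin n → Sum m tm) → Fin (suc n) → Sum (suc m) tm
exts σ zero    = var zero ∷ []
exts σ (suc i) = map weaken (σ i)

mutual
  subst : ∀ {n m s} → (Fin n → Sum m tm) → Exp n s → Sum m s
  subst σ (var i)    = σ i
  subst σ (lam M)    = map lam (subst (exts σ) M)
  subst σ (app M P)  = concatMap (λ M' → map (app M') (subst σ P)) (subst σ M)
  subst σ (tbar V)   = map tbar (subst σ V)
  subst σ (bag Ls N) = map (λ Ls' → bag Ls' (substSum σ N)) (substList σ Ls)
  subst σ (test Ls)  = map test (substList σ Ls)

  substList : ∀ {n m} → (Fin n → Sum m tm) → List (Exp n tm) → List (List (Exp m tm))
  substList σ []       = [] ∷ []
  substList σ (L ∷ Ls) = concatMap (λ L' → map (L' ∷_) (substList σ Ls)) (subst σ L)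

  substSum : ∀ {n m} → (Fin n → Sum m tm) → Sum n tm → Sum m tm
  substSum σ []       = []
  substSum σ (e ∷ es) = subst σ e ++ substSum σ es

σ₀ : ∀ {n} → Sum n tm → Fin (suc n) → Sum n tm
σ₀ N zero    = N
σ₀ N (suc i) = var i ∷ []

mutual
  lsub : ∀ {n s} → Fin n → Exp n tm → Exp n s → Sum n s
  lsub x N (var y)    = if does (x ≟ y) then N ∷ [] else []
  lsub x N (lam M)    = map lam (lsub (suc x) (weaken N) M)
  lsub x N (app M P)  = map (λ M' → app M' P) (lsub x N M) ++ map (app M) (lsub x N P)
  lsub x N (tbar V)   = map tbar (lsub x N V)
  lsub x N (bag Ls 𝐍) = map (λ Ls' → bag Ls' 𝐍) (lsubList x N Ls)
                        ++ map (λ M' → bag (Ls ∷ʳ M') 𝐍) (lsubSum x N 𝐍)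
  lsub x N (test Ls)  = map test (lsubList x N Ls)

  lsubList : ∀ {n} → Fin n → Exp n tm → List (Exp n tm) → List (List (Exp n tm))
  lsubList x N []       = []
  lsubList x N (L ∷ Ls) = map (_∷ Ls) (lsub x N L) ++ map (L ∷_) (lsubList x N Ls)

  lsubSum : ∀ {n} → Fin n → Exp n tm → Sum n tm → Sum n tm
  lsubSum x N []       = []
  lsubSum x N (e ∷ es) = lsub x N e ++ lsubSum x N es

-- 𝔸⟨[L₁,…,L_k]/x⟩ = 𝔸⟨L₁/x⟩⋯⟨L_k/x⟩  for x = zero, the Lᵢ living outside x
lsubMany : ∀ {n} → Sum (suc n) tm → List (Exp n tm) → Sum (suc n) tm
lsubMany A []       = A
lsubMany A (L ∷ Ls) = lsubMany (concatMap (lsub zero (weaken L)) A) Ls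

-- Structural equivalence: sums are sets (commutative, associative,
-- idempotent +), bags' linear parts and tests are multisets.

mutual
  data _~_ : ∀ {n s} → Exp n s → Exp n s → Set where
    var  : ∀ {n} {i : Fin n} → var i ~ var i
    lam  : ∀ {n} {M M' : Exp (suc n) tm} → M ~ M' → lam M ~ lam M'
    app  : ∀ {n} {M M' : Exp n tm} {P P'} → M ~ M' → P ~ P' → app M P ~ app M' P'
    tbar : ∀ {n} {V V' : Exp n ts} → V ~ V' → tbar V ~ tbar V'
    bag  : ∀ {n} {Ls Ls' N N' : List (Exp n tm)} → Ls ~ₘ Ls' → N ~ₛ N' → bag Ls N ~ bag Ls' N'
    test : ∀ {n} {Ls Ls' : List (Exp n tm)} → Ls ~ₘ Ls' → test Ls ~ test Ls'

  data _~ₘ_ {n : ℕ} : List (Exp n tm) → List (Exp n tm) → Set where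
    []  : [] ~ₘ []
    cons : ∀ {L L' Ls} Ls₁ Ls₂ → L ~ L' → Ls ~ₘ (Ls₁ ++ Ls₂) → (L ∷ Ls) ~ₘ (Ls₁ ++ L' ∷ Ls₂)

  data _~ₛ_ {n : ℕ} {s : Sort} : Sum n s → Sum n s → Set where
    sums : ∀ {A B}
         → (∀ {e} → e ∈ A → ∃ λ e' → e' ∈ B × e ~ e')
         → (∀ {e'} → e' ∈ B → ∃ λ e → e ∈ A × e ~ e')
         → A ~ₛ B

data _⟶_ : ∀ {n s} → Exp n s → Sum n s → Set where
  beta     : ∀ {n} (M : Exp (suc n) tm) (Ls N : List (Exp n tm))
           → app (lam M) (bag Ls N) ⟶ concatMap (subst (σ₀ N)) (lsubMany (M ∷ []) Ls)
  tbar-nil : ∀ {n} (V : Exp n ts) (N : List (Exp n tm))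
           → app (tbar V) (bag [] N) ⟶ (tbar V ∷ [])
  tbar-cons : ∀ {n} (V : Exp n ts) (L : Exp n tm) (Ls N : List (Exp n tm))
           → app (tbar V) (bag (L ∷ Ls) N) ⟶ []
  test-lam : ∀ {n} (M : Exp (suc n) tm) (Ls : List (Exp n tm))
           → test (lam M ∷ Ls) ⟶ map (λ M' → test (M' ∷ Ls)) (subst (σ₀ []) M)
  test-tbar : ∀ {n} (Ks Ls : List (Exp n tm))
           → test (tbar (test Ks) ∷ Ls) ⟶ (test (Ks ++ Ls) ∷ [])
  c-lam    : ∀ {n} {M : Exp (suc n) tm} {𝕄} → M ⟶ 𝕄 → lam M ⟶ map lam 𝕄
  c-appₗ   : ∀ {n} {M : Exp n tm} {𝕄} (P : Exp n bg) → M ⟶ 𝕄 → app M P ⟶ map (λ M' → app M' P) 𝕄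
  c-appᵣ   : ∀ {n} (M : Exp n tm) {P ℙ} → P ⟶ ℙ → app M P ⟶ map (app M) ℙ
  c-tbar   : ∀ {n} {V : Exp n ts} {𝕍} → V ⟶ 𝕍 → tbar V ⟶ map tbar 𝕍
  c-bagₗ   : ∀ {n} (Ls₁ Ls₂ N : List (Exp n tm)) {L 𝕃} → L ⟶ 𝕃
           → bag (Ls₁ ++ L ∷ Ls₂) N ⟶ map (λ L' → bag (Ls₁ ++ L' ∷ Ls₂) N) 𝕃
  c-bag!   : ∀ {n} (Ls N₁ N₂ : List (Exp n tm)) {M 𝕄} → M ⟶ 𝕄
           → bag Ls (N₁ ++ M ∷ N₂) ⟶ (bag Ls (N₁ ++ 𝕄 ++ N₂) ∷ [])
  c-test   : ∀ {n} (Ls₁ Ls₂ : List (Exp n tm)) {L 𝕃} → L ⟶ 𝕃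
           → test (Ls₁ ++ L ∷ Ls₂) ⟶ map (λ L' → test (Ls₁ ++ L' ∷ Ls₂)) 𝕃

data _⇒_ {n : ℕ} {s : Sort} : Sum n s → Sum n s → Set where
  step  : ∀ (A₁ A₂ : Sum n s) {e 𝔼} → e ⟶ 𝔼 → (A₁ ++ e ∷ A₂) ⇒ (A₁ ++ 𝔼 ++ A₂)
  equal : ∀ {A B} → A ~ₛ B → A ⇒ B

_↠_ : ∀ {n s} → Sum n s → Sum n s → Set
_↠_ = Star _⇒_

-- Raw representation: an element is a finite list of
-- finite multisets (lists); the sequence is completed by empty
-- multisets. Equality _≈_ identifies trailing empties and permutations.

data D : Set where
  seq : List (List D) → D

mutual
  data _≈_ : D → D → Set where
    seq≈ : ∀ {s t} → s ≈ₛ t → seq s ≈ seq t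

  data _≈ₛ_ : List (List D) → List (List D) → Set where
    []   : [] ≈ₛ []
    _∷_  : ∀ {a b s t} → a ≈ₘ b → s ≈ₛ t → (a ∷ s) ≈ₛ (b ∷ t)
    padˡ : ∀ {t} → [] ≈ₛ t → [] ≈ₛ ([] ∷ t)
    padʳ : ∀ {s} → s ≈ₛ [] → ([] ∷ s) ≈ₛ []

  data _≈ₘ_ : List D → List D → Set where
    []   : [] ≈ₘ []
    cons : ∀ {x y a} b₁ b₂ → x ≈ y → a ≈ₘ (b₁ ++ b₂) → (x ∷ a) ≈ₘ (b₁ ++ y ∷ b₂)

_::_ : List D → D → D
a :: seq s = seq (a ∷ s)

⋆ : D
⋆ = seq []

Env : ℕ → Set
Env n = Vec (List D) n

_⊕_ : ∀ {n} → Env n → Env n → Env n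
_⊕_ = zipWith _++_

∅ : ∀ {n} → Env n
∅ = replicate _ []

single : ∀ {n} → Fin n → D → Env n
single i α = ∅ [ i ]≔ (α ∷ [])

_≋_ : ∀ {n} → Env n → Env n → Set
_≋_ = Pointwise _≈ₘ_

Val : Sort → Set
Val tm = D
Val bg = List D
Val ts = ⊤

-- Interpretation ⟦A⟧ ⊆ ℳ_f(𝒟)^n × Val, as a predicate

mutual
  ⟦_⟧ : ∀ {n s} → Exp n s → Env n → Val s → Set
  ⟦ var i ⟧    ρ α = ρ ≋ single i α
  ⟦ lam M ⟧    ρ α = ∃₂ λ b β → α ≈ (b :: β) × ⟦ M ⟧ (b ∷ ρ) β
  ⟦ app M P ⟧  ρ α = ∃ λ b → ∃₂ λ ρ₁ ρ₂ → ρ ≋ (ρ₁ ⊕ ρ₂) × ⟦ M ⟧ ρ₁ (b :: α) × ⟦ P ⟧ ρ₂ b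
  ⟦ tbar V ⟧   ρ α = α ≈ ⋆ × ⟦ V ⟧ ρ tt
  ⟦ bag Ls N ⟧ ρ β = ∃₂ λ ρ₁ ρ₂ → ∃₂ λ βs γs →
                       ρ ≋ (ρ₁ ⊕ ρ₂) × Lin Ls ρ₁ βs × Prom N ρ₂ γs × β ≈ₘ (βs ++ γs)
  ⟦ test Ls ⟧  ρ _ = Tst Ls ρ

  Lin : ∀ {n} → List (Exp n tm) → Env n → List D → Set
  Lin []       ρ βs = ρ ≋ ∅ × βs ≡ []
  Lin (L ∷ Ls) ρ βs = ∃₂ λ β βs' → ∃₂ λ ρ₁ ρ₂ →
                        βs ≡ β ∷ βs' × ρ ≋ (ρ₁ ⊕ ρ₂) × ⟦ L ⟧ ρ₁ β × Lin Ls ρ₂ βs'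

  Prom : ∀ {n} → Sum n tm → Env n → List D → Set
  Prom N ρ []       = ρ ≋ ∅
  Prom N ρ (γ ∷ γs) = ∃₂ λ ρ₁ ρ₂ → ρ ≋ (ρ₁ ⊕ ρ₂) × ⟦ N ⟧Σ ρ₁ γ × Prom N ρ₂ γs

  Tst : ∀ {n} → List (Exp n tm) → Env n → Set
  Tst []       ρ = ρ ≋ ∅
  Tst (L ∷ Ls) ρ = ∃₂ λ ρ₁ ρ₂ → ρ ≋ (ρ₁ ⊕ ρ₂) × ⟦ L ⟧ ρ₁ ⋆ × Tst Ls ρ₂

  ⟦_⟧Σ : ∀ {n s} → Sum n s → Env n → Val s → Set
  ⟦ [] ⟧Σ     ρ v = ⊥
  ⟦ e ∷ es ⟧Σ ρ v = ⟦ e ⟧ ρ v ⊎ ⟦ es ⟧Σ ρ v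

-- Sums are unions and every constructor is
-- interpreted linearly in each argument, so the contextual rules follow
-- by pushing the interpretation of a summand through its context, and
-- structural equivalence is harmless because environments and bags are
-- only read up to permutation.  The content lies in the two substitution
-- lemmas behind β: an environment of A{𝐍/x} is an environment of A in
-- which the multiset of values of x is realised by the promotion 𝐍^!,
-- and an environment of A⟨N/x⟩ is one of A in which a single occurrence
-- of x, of value β, is traded for an environment in which N yields β.
-- Iterating the linear lemma over the linear part of the bag and then
-- substituting the promoted part recovers ⟦(λx.M)P⟧.  The test rules
-- rest on ⋆ = [] :: ⋆.
module Submission where

open import Defs

open import Algebra.Bundles using (CommutativeMonoid)
import Algebra.Properties.CommutativeSemigroup
import Algebra.Solver.CommutativeMonoid
open import Data.Empty using (⊥; ⊥-elim)
open import Data.Fin using (Fin; zero; suc; _≟_)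
open import Data.List using (List; []; _∷_; _++_; map; concatMap; _∷ʳ_)
open import Data.List.Membership.Propositional using (_∈_; find; lose)
open import Data.List.Membership.Propositional.Properties
  using (∈-map⁺; ∈-map⁻; ∈-++⁺ˡ; ∈-++⁺ʳ; ∈-++⁻; ∈-concatMap⁺; ∈-concatMap⁻)
open import Data.List.Properties using (++-assoc; ++-identityʳ; ∷-injective)
open import Data.List.Relation.Unary.Any using (Any; here; there)
import Data.List.Relation.Unary.Any.Properties as Any
open import Data.Nat using (ℕ; zero; suc)
open import Data.Product using (∃; ∃₂; _×_; _,_; map₂)
open import Data.Sum using (_⊎_; inj₁; inj₂)
import Data.Sum as Sum
open import Data.Unit using (⊤; tt)
open import Data.Vec using ([]; _∷_; _[_]≔_)
open import Data.Vec.Relation.Binary.Pointwise.Inductive using ([]; _∷_)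
open import Function.Bundles using (_⇔_; mk⇔; Equivalence)
import Function.Properties.Equivalence as ⇔
open import Level using (0ℓ)
open import Relation.Binary.Construct.Closure.ReflexiveTransitive using (ε; _◅_)
open import Relation.Binary.PropositionalEquality using (_≡_; refl; sym; cong)
open import Relation.Nullary using (yes; no)

++-∷-split : ∀ {A : Set} (d₁ d₂ e₁ : List A) (z : A) (e₂ : List A) → d₁ ++ d₂ ≡ e₁ ++ z ∷ e₂ →
  (∃ λ v → d₁ ≡ e₁ ++ z ∷ v × e₂ ≡ v ++ d₂) ⊎ (∃ λ v → e₁ ≡ d₁ ++ v × d₂ ≡ v ++ z ∷ e₂)
++-∷-split [] d₂ e₁ z e₂ eq = inj₂ (e₁ , refl , eq)
++-∷-split (x ∷ d₁) d₂ [] z e₂ refl = inj₁ (d₁ , refl , refl)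
++-∷-split (x ∷ d₁) d₂ (y ∷ e₁) z e₂ eq with ∷-injective eq
... | refl , eq′ with ++-∷-split d₁ d₂ e₁ z e₂ eq′
... | inj₁ (v , p , q) = inj₁ (v , cong (x ∷_) p , q)
... | inj₂ (v , p , q) = inj₂ (v , cong (x ∷_) p , q)

≈ₘ-resp-≡ʳ : ∀ {a b c} → a ≈ₘ b → b ≡ c → a ≈ₘ c
≈ₘ-resp-≡ʳ p refl = p

≈ₘ-[]ʳ : ∀ {a} → a ≈ₘ [] → a ≡ []
≈ₘ-[]ʳ p = go p refl
  where
  -- [] cannot be unified with the stuck index b₁ ++ y ∷ b₂ of cons.
  go : ∀ {a c} → a ≈ₘ c → c ≡ [] → a ≡ []
  go [] _ = refl
  go (cons [] _ _ _) ()
  go (cons (_ ∷ _) _ _ _) ()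

≈ₘ-[]ˡ : ∀ {c} → [] ≈ₘ c → c ≡ []
≈ₘ-[]ˡ [] = refl

mutual
  ≈-refl : ∀ x → x ≈ x
  ≈-refl (seq s) = seq≈ (≈ₛ-refl s)

  ≈ₛ-refl : ∀ s → s ≈ₛ s
  ≈ₛ-refl [] = []
  ≈ₛ-refl (a ∷ s) = ≈ₘ-refl a ∷ ≈ₛ-refl s

  ≈ₘ-refl : ∀ a → a ≈ₘ a
  ≈ₘ-refl [] = []
  ≈ₘ-refl (x ∷ a) = cons [] a (≈-refl x) (≈ₘ-refl a)

≈ₘ-insert : ∀ {y x} b₁ {b₂ a} → (b₁ ++ b₂) ≈ₘ a → y ≈ x → (b₁ ++ y ∷ b₂) ≈ₘ (x ∷ a)
≈ₘ-insert [] q p = cons [] _ p q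
≈ₘ-insert (w ∷ b₁) (cons c₁ c₂ wu q) p = cons (_ ∷ c₁) c₂ wu (≈ₘ-insert b₁ q p)

≈ₘ-delete : ∀ b₁ {y b₂ c} → (b₁ ++ y ∷ b₂) ≈ₘ c →
  ∃ λ c₁ → ∃ λ c₂ → ∃ λ z → c ≡ c₁ ++ z ∷ c₂ × y ≈ z × (b₁ ++ b₂) ≈ₘ (c₁ ++ c₂)
≈ₘ-delete [] (cons c₁ c₂ p q) = c₁ , c₂ , _ , refl , p , q
≈ₘ-delete (w ∷ b₁) (cons d₁ d₂ wu rest) with ≈ₘ-delete b₁ rest
... | e₁ , e₂ , z , eq , yz , r with ++-∷-split d₁ d₂ e₁ z e₂ eq
... | inj₁ (v , refl , refl) =
  e₁ , v ++ _ ∷ d₂ , z , ++-assoc e₁ (z ∷ v) (_ ∷ d₂) , yz ,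
  ≈ₘ-resp-≡ʳ (cons (e₁ ++ v) d₂ wu (≈ₘ-resp-≡ʳ r (sym (++-assoc e₁ v d₂)))) (++-assoc e₁ v (_ ∷ d₂))
... | inj₂ (v , refl , refl) =
  d₁ ++ _ ∷ v , e₂ , z , sym (++-assoc d₁ (_ ∷ v) (z ∷ e₂)) , yz ,
  ≈ₘ-resp-≡ʳ (cons d₁ (v ++ e₂) wu (≈ₘ-resp-≡ʳ r (++-assoc d₁ v e₂))) (sym (++-assoc d₁ (_ ∷ v) e₂))

mutual
  ≈-sym : ∀ {x y} → x ≈ y → y ≈ x
  ≈-sym (seq≈ p) = seq≈ (≈ₛ-sym p)

  ≈ₛ-sym : ∀ {x y} → x ≈ₛ y → y ≈ₛ x
  ≈ₛ-sym [] = []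
  ≈ₛ-sym (p ∷ q) = ≈ₘ-sym p ∷ ≈ₛ-sym q
  ≈ₛ-sym (padˡ p) = padʳ (≈ₛ-sym p)
  ≈ₛ-sym (padʳ p) = padˡ (≈ₛ-sym p)

  ≈ₘ-sym : ∀ {x y} → x ≈ₘ y → y ≈ₘ x
  ≈ₘ-sym [] = []
  ≈ₘ-sym (cons b₁ b₂ p q) = ≈ₘ-insert b₁ (≈ₘ-sym q) (≈-sym p)

mutual
  ≈-trans : ∀ {x y z} → x ≈ y → y ≈ z → x ≈ z
  ≈-trans (seq≈ p) (seq≈ q) = seq≈ (≈ₛ-trans p q)

  ≈ₛ-trans : ∀ {x y z} → x ≈ₛ y → y ≈ₛ z → x ≈ₛ z
  ≈ₛ-trans [] r = r
  ≈ₛ-trans (p ∷ q) (p′ ∷ q′) = ≈ₘ-trans p p′ ∷ ≈ₛ-trans q q′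
  ≈ₛ-trans (p ∷ q) (padʳ q′) with ≈ₘ-[]ʳ p
  ... | refl = padʳ (≈ₛ-trans q q′)
  ≈ₛ-trans (padˡ p) (p′ ∷ q′) with ≈ₘ-[]ˡ p′
  ... | refl = padˡ (≈ₛ-trans p q′)
  ≈ₛ-trans (padˡ p) (padʳ q′) = []
  ≈ₛ-trans (padʳ p) [] = padʳ p
  ≈ₛ-trans (padʳ p) (padˡ r) = [] ∷ ≈ₛ-trans p r

  ≈ₘ-trans : ∀ {x y z} → x ≈ₘ y → y ≈ₘ z → x ≈ₘ z
  ≈ₘ-trans [] r = r
  ≈ₘ-trans (cons b₁ b₂ p q) r with ≈ₘ-delete b₁ r
  ... | c₁ , c₂ , z , refl , yz , r′ = cons c₁ c₂ (≈-trans p yz) (≈ₘ-trans q r′)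

≈ₘ-++ : ∀ {a a′ b b′} → a ≈ₘ a′ → b ≈ₘ b′ → (a ++ b) ≈ₘ (a′ ++ b′)
≈ₘ-++ [] q = q
≈ₘ-++ {b′ = b′} (cons b₁ b₂ p q) r =
  ≈ₘ-resp-≡ʳ (cons b₁ (b₂ ++ b′) p (≈ₘ-resp-≡ʳ (≈ₘ-++ q r) (++-assoc b₁ b₂ b′))) (sym (++-assoc b₁ (_ ∷ b₂) b′))

≈ₘ-++-comm : ∀ a b → (a ++ b) ≈ₘ (b ++ a)
≈ₘ-++-comm [] b = ≈ₘ-resp-≡ʳ (≈ₘ-refl b) (sym (++-identityʳ b))
≈ₘ-++-comm (x ∷ a) b = cons b a (≈-refl x) (≈ₘ-++-comm a b)

≈ₘ-++-identityʳ : ∀ c → (c ++ []) ≈ₘ c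
≈ₘ-++-identityʳ c = ≈ₘ-resp-≡ʳ (≈ₘ-refl (c ++ [])) (++-identityʳ c)

≋-refl : ∀ {n} (ρ : Env n) → ρ ≋ ρ
≋-refl [] = []
≋-refl (a ∷ ρ) = ≈ₘ-refl a ∷ ≋-refl ρ

≋-sym : ∀ {n} {ρ σ : Env n} → ρ ≋ σ → σ ≋ ρ
≋-sym [] = []
≋-sym (p ∷ q) = ≈ₘ-sym p ∷ ≋-sym q

≋-trans : ∀ {n} {ρ σ τ : Env n} → ρ ≋ σ → σ ≋ τ → ρ ≋ τ
≋-trans [] [] = []
≋-trans (p ∷ q) (p′ ∷ q′) = ≈ₘ-trans p p′ ∷ ≋-trans q q′

⊕-cong : ∀ {n} {ρ ρ′ σ σ′ : Env n} → ρ ≋ ρ′ → σ ≋ σ′ → (ρ ⊕ σ) ≋ (ρ′ ⊕ σ′)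
⊕-cong [] [] = []
⊕-cong (p ∷ q) (p′ ∷ q′) = ≈ₘ-++ p p′ ∷ ⊕-cong q q′

⊕-comm : ∀ {n} (ρ σ : Env n) → (ρ ⊕ σ) ≋ (σ ⊕ ρ)
⊕-comm [] [] = []
⊕-comm (a ∷ ρ) (b ∷ σ) = ≈ₘ-++-comm a b ∷ ⊕-comm ρ σ

⊕-assoc : ∀ {n} (ρ σ τ : Env n) → ((ρ ⊕ σ) ⊕ τ) ≋ (ρ ⊕ (σ ⊕ τ))
⊕-assoc [] [] [] = []
⊕-assoc (a ∷ ρ) (b ∷ σ) (c ∷ τ) = ≈ₘ-resp-≡ʳ (≈ₘ-refl _) (++-assoc a b c) ∷ ⊕-assoc ρ σ τ

⊕-identityˡ : ∀ {n} (ρ : Env n) → (∅ ⊕ ρ) ≋ ρ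
⊕-identityˡ [] = []
⊕-identityˡ (a ∷ ρ) = ≈ₘ-refl a ∷ ⊕-identityˡ ρ

⊕-identityʳ : ∀ {n} (ρ : Env n) → (ρ ⊕ ∅) ≋ ρ
⊕-identityʳ ρ = ≋-trans (⊕-comm ρ ∅) (⊕-identityˡ ρ)

⊕-commutativeMonoid : ℕ → CommutativeMonoid 0ℓ 0ℓ
⊕-commutativeMonoid n = record
  { Carrier = Env n ; _≈_ = _≋_ ; _∙_ = _⊕_ ; ε = ∅
  ; isCommutativeMonoid = record
    { isMonoid = record
      { isSemigroup = record
        { isMagma = record
          { isEquivalence = record { refl = ≋-refl _ ; sym = ≋-sym ; trans = ≋-trans }
          ; ∙-cong = ⊕-cong }
        ; assoc = ⊕-assoc }
      ; identity = ⊕-identityˡ , ⊕-identityʳ }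
    ; comm = ⊕-comm } }

module ⊕-Properties {n : ℕ} =
  Algebra.Properties.CommutativeSemigroup (CommutativeMonoid.commutativeSemigroup (⊕-commutativeMonoid n))
open ⊕-Properties using (interchange; x∙yz≈y∙xz; xy∙z≈xz∙y)

module ⊕-Solver {n : ℕ} = Algebra.Solver.CommutativeMonoid (⊕-commutativeMonoid n)
open ⊕-Solver using (solve; _⊜_) renaming (_⊕_ to _⊞_)

refineˡ : ∀ {n} {ρ a a′ b : Env n} → ρ ≋ (a ⊕ b) → a ≋ a′ → ρ ≋ (a′ ⊕ b)
refineˡ {b = b} p q = ≋-trans p (⊕-cong q (≋-refl b))

refineʳ : ∀ {n} {ρ a b b′ : Env n} → ρ ≋ (a ⊕ b) → b ≋ b′ → ρ ≋ (a ⊕ b′)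
refineʳ {a = a} p q = ≋-trans p (⊕-cong (≋-refl a) q)

refineʳ-assoc : ∀ {n} {ρ a b c d : Env n} → ρ ≋ (a ⊕ b) → b ≋ (c ⊕ d) → ρ ≋ ((a ⊕ c) ⊕ d)
refineʳ-assoc {a = a} {c = c} {d} p q = ≋-trans (refineʳ p q) (≋-sym (⊕-assoc a c d))

refineˡ-assoc : ∀ {n} {ρ a b c d : Env n} → ρ ≋ (a ⊕ b) → a ≋ (c ⊕ d) → ρ ≋ (c ⊕ (d ⊕ b))
refineˡ-assoc {b = b} {c} {d} p q = ≋-trans (refineˡ p q) (⊕-assoc c d b)

refineʳ-swap : ∀ {n} {ρ a b c d : Env n} → ρ ≋ (a ⊕ b) → b ≋ (c ⊕ d) → ρ ≋ (c ⊕ (a ⊕ d))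
refineʳ-swap {a = a} {c = c} {d} p q = ≋-trans (refineʳ p q) (x∙yz≈y∙xz a c d)

refineˡ-swap : ∀ {n} {ρ a b c d : Env n} → ρ ≋ (a ⊕ b) → a ≋ (c ⊕ d) → ρ ≋ ((c ⊕ b) ⊕ d)
refineˡ-swap {b = b} {c} {d} p q = ≋-trans (refineˡ p q) (xy∙z≈xz∙y c d b)

_≈ᵥ_ : ∀ {s} → Val s → Val s → Set
_≈ᵥ_ {tm} = _≈_
_≈ᵥ_ {bg} = _≈ₘ_
_≈ᵥ_ {ts} = λ _ _ → ⊤

≈ᵥ-refl : ∀ {s} (v : Val s) → v ≈ᵥ v
≈ᵥ-refl {tm} v = ≈-refl v
≈ᵥ-refl {bg} v = ≈ₘ-refl v
≈ᵥ-refl {ts} v = tt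

::-congʳ : ∀ b {α α′} → α ≈ α′ → (b :: α) ≈ (b :: α′)
::-congʳ b (seq≈ p) = seq≈ (≈ₘ-refl b ∷ p)

::-congˡ : ∀ {b c} (β : D) → b ≈ₘ c → (b :: β) ≈ (c :: β)
::-congˡ (seq s) p = seq≈ (p ∷ ≈ₛ-refl s)

single-cong : ∀ {n} (i : Fin n) {α α′} → α ≈ α′ → single i α ≋ single i α′
single-cong zero p = cons [] [] p [] ∷ ≋-refl _
single-cong (suc i) p = [] ∷ single-cong i p

mutual
  ⟦⟧-resp : ∀ {n s} (e : Exp n s) {ρ ρ′ v v′} → ρ ≋ ρ′ → v ≈ᵥ v′ → ⟦ e ⟧ ρ v → ⟦ e ⟧ ρ′ v′
  ⟦⟧-resp (var i) r p h = ≋-trans (≋-sym r) (≋-trans h (single-cong i p))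
  ⟦⟧-resp (lam M) r p (b , β , q , m) = b , β , ≈-trans (≈-sym p) q , ⟦⟧-resp M (≈ₘ-refl b ∷ r) (≈-refl β) m
  ⟦⟧-resp (app M P) r p (b , ρ₁ , ρ₂ , q , m , h) =
    b , ρ₁ , ρ₂ , ≋-trans (≋-sym r) q , ⟦⟧-resp M (≋-refl ρ₁) (::-congʳ b p) m , h
  ⟦⟧-resp (tbar V) r p (q , h) = ≈-trans (≈-sym p) q , ⟦⟧-resp V r tt h
  ⟦⟧-resp (bag Ls N) r p (ρ₁ , ρ₂ , βs , γs , q , l , h , w) =
    ρ₁ , ρ₂ , βs , γs , ≋-trans (≋-sym r) q , l , h , ≈ₘ-trans (≈ₘ-sym p) w
  ⟦⟧-resp (test Ls) r p h = Tst-resp Ls r h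

  Tst-resp : ∀ {n} (Ls : List (Exp n tm)) {ρ ρ′} → ρ ≋ ρ′ → Tst Ls ρ → Tst Ls ρ′
  Tst-resp [] r h = ≋-trans (≋-sym r) h
  Tst-resp (L ∷ Ls) r (ρ₁ , ρ₂ , q , h) = ρ₁ , ρ₂ , ≋-trans (≋-sym r) q , h

⟦⟧Σ-resp : ∀ {n s} (N : Sum n s) {ρ ρ′ v v′} → ρ ≋ ρ′ → v ≈ᵥ v′ → ⟦ N ⟧Σ ρ v → ⟦ N ⟧Σ ρ′ v′
⟦⟧Σ-resp (e ∷ N) r p (inj₁ h) = inj₁ (⟦⟧-resp e r p h)
⟦⟧Σ-resp (e ∷ N) r p (inj₂ h) = inj₂ (⟦⟧Σ-resp N r p h)

Lin-resp : ∀ {n} (Ls : List (Exp n tm)) {ρ ρ′ βs} → ρ ≋ ρ′ → Lin Ls ρ βs → Lin Ls ρ′ βs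
Lin-resp [] r (q , e) = ≋-trans (≋-sym r) q , e
Lin-resp (L ∷ Ls) r (β , βs , ρ₁ , ρ₂ , e , q , h) = β , βs , ρ₁ , ρ₂ , e , ≋-trans (≋-sym r) q , h

Prom-resp : ∀ {n} (N : Sum n tm) {ρ ρ′ γs} → ρ ≋ ρ′ → Prom N ρ γs → Prom N ρ′ γs
Prom-resp N {γs = []} r q = ≋-trans (≋-sym r) q
Prom-resp N {γs = γ ∷ γs} r (ρ₁ , ρ₂ , q , h) = ρ₁ , ρ₂ , ≋-trans (≋-sym r) q , h

module _ {n s} {ρ : Env n} {v : Val s} where

  ⟦⟧Σ⇒Any : ∀ {A : Sum n s} → ⟦ A ⟧Σ ρ v → Any (λ e → ⟦ e ⟧ ρ v) A
  ⟦⟧Σ⇒Any {e ∷ A} (inj₁ h) = here h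
  ⟦⟧Σ⇒Any {e ∷ A} (inj₂ h) = there (⟦⟧Σ⇒Any h)

  Any⇒⟦⟧Σ : ∀ {A : Sum n s} → Any (λ e → ⟦ e ⟧ ρ v) A → ⟦ A ⟧Σ ρ v
  Any⇒⟦⟧Σ (here h) = inj₁ h
  Any⇒⟦⟧Σ (there h) = inj₂ (Any⇒⟦⟧Σ h)

  ⟦⟧Σ-find : ∀ {A : Sum n s} → ⟦ A ⟧Σ ρ v → ∃ λ e → e ∈ A × ⟦ e ⟧ ρ v
  ⟦⟧Σ-find h = find (⟦⟧Σ⇒Any h)

  ⟦⟧Σ-lose : ∀ {A : Sum n s} {e} → e ∈ A → ⟦ e ⟧ ρ v → ⟦ A ⟧Σ ρ v
  ⟦⟧Σ-lose m h = Any⇒⟦⟧Σ (lose m h)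

  ⟦⟧Σ-++⁻ : ∀ (A : Sum n s) {B} → ⟦ A ++ B ⟧Σ ρ v → ⟦ A ⟧Σ ρ v ⊎ ⟦ B ⟧Σ ρ v
  ⟦⟧Σ-++⁻ A h = Sum.map Any⇒⟦⟧Σ Any⇒⟦⟧Σ (Any.++⁻ A (⟦⟧Σ⇒Any h))

  ⟦⟧Σ-++⁺ˡ : ∀ {A B : Sum n s} → ⟦ A ⟧Σ ρ v → ⟦ A ++ B ⟧Σ ρ v
  ⟦⟧Σ-++⁺ˡ h = Any⇒⟦⟧Σ (Any.++⁺ˡ (⟦⟧Σ⇒Any h))

  ⟦⟧Σ-++⁺ʳ : ∀ (A : Sum n s) {B} → ⟦ B ⟧Σ ρ v → ⟦ A ++ B ⟧Σ ρ v
  ⟦⟧Σ-++⁺ʳ A h = Any⇒⟦⟧Σ (Any.++⁺ʳ A (⟦⟧Σ⇒Any h))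

  ⟦⟧Σ-map⁻ : ∀ {X : Set} (f : X → Exp n s) (A : List X) → ⟦ map f A ⟧Σ ρ v → ∃ λ x → x ∈ A × ⟦ f x ⟧ ρ v
  ⟦⟧Σ-map⁻ f A h = find (Any.map⁻ (⟦⟧Σ⇒Any h))

  ⟦⟧Σ-map⁺ : ∀ {X : Set} (f : X → Exp n s) {A : List X} {x} → x ∈ A → ⟦ f x ⟧ ρ v → ⟦ map f A ⟧Σ ρ v
  ⟦⟧Σ-map⁺ f m h = Any⇒⟦⟧Σ (Any.map⁺ (lose m h))

  ⟦⟧Σ-concatMap⁻ : ∀ {X : Set} (f : X → Sum n s) (A : List X) → ⟦ concatMap f A ⟧Σ ρ v → ∃ λ x → x ∈ A × ⟦ f x ⟧Σ ρ v
  ⟦⟧Σ-concatMap⁻ f A h with find (Any.concatMap⁻ f (⟦⟧Σ⇒Any h))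
  ... | x , m , h′ = x , m , Any⇒⟦⟧Σ h′

  ⟦⟧Σ-concatMap⁺ : ∀ {X : Set} (f : X → Sum n s) {A : List X} {x} → x ∈ A → ⟦ f x ⟧Σ ρ v → ⟦ concatMap f A ⟧Σ ρ v
  ⟦⟧Σ-concatMap⁺ f m h = Any⇒⟦⟧Σ (Any.concatMap⁺ f (lose m (⟦⟧Σ⇒Any h)))

Lin-++⁻ : ∀ {n} (X : List (Exp n tm)) {Y ρ βs} → Lin (X ++ Y) ρ βs →
  ∃₂ λ βs₁ βs₂ → ∃₂ λ ρ₁ ρ₂ → βs ≡ βs₁ ++ βs₂ × ρ ≋ (ρ₁ ⊕ ρ₂) × Lin X ρ₁ βs₁ × Lin Y ρ₂ βs₂
Lin-++⁻ [] {ρ = ρ} {βs} h = [] , βs , ∅ , ρ , refl , ≋-sym (⊕-identityˡ ρ) , (≋-refl ∅ , refl) , h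
Lin-++⁻ (L ∷ X) (β , _ , ρa , _ , refl , q , l , h) with Lin-++⁻ X h
... | βs₁ , βs₂ , ρ₁ , ρ₂ , refl , q′ , h₁ , h₂ =
  β ∷ βs₁ , βs₂ , ρa ⊕ ρ₁ , ρ₂ , refl , refineʳ-assoc q q′ , (β , βs₁ , ρa , ρ₁ , refl , ≋-refl _ , l , h₁) , h₂

Lin-++⁺ : ∀ {n} (X : List (Exp n tm)) {Y ρ ρ₁ ρ₂ βs₁ βs₂} →
  ρ ≋ (ρ₁ ⊕ ρ₂) → Lin X ρ₁ βs₁ → Lin Y ρ₂ βs₂ → Lin (X ++ Y) ρ (βs₁ ++ βs₂)
Lin-++⁺ [] {Y} q (e , refl) h = Lin-resp Y (≋-sym (≋-trans (refineˡ q e) (⊕-identityˡ _))) h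
Lin-++⁺ (L ∷ X) q (β , _ , ρa , _ , refl , q′ , l , h₁) h₂ =
  β , _ , ρa , _ , refl , refineˡ-assoc q q′ , l , Lin-++⁺ X (≋-refl _) h₁ h₂

Tst-++⁻ : ∀ {n} (X : List (Exp n tm)) {Y ρ} → Tst (X ++ Y) ρ →
  ∃₂ λ ρ₁ ρ₂ → ρ ≋ (ρ₁ ⊕ ρ₂) × Tst X ρ₁ × Tst Y ρ₂
Tst-++⁻ [] {ρ = ρ} h = ∅ , ρ , ≋-sym (⊕-identityˡ ρ) , ≋-refl ∅ , h
Tst-++⁻ (L ∷ X) (ρa , _ , q , l , h) with Tst-++⁻ X h
... | ρ₁ , ρ₂ , q′ , h₁ , h₂ = ρa ⊕ ρ₁ , ρ₂ , refineʳ-assoc q q′ , (ρa , ρ₁ , ≋-refl _ , l , h₁) , h₂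

Tst-++⁺ : ∀ {n} (X : List (Exp n tm)) {Y ρ ρ₁ ρ₂} → ρ ≋ (ρ₁ ⊕ ρ₂) → Tst X ρ₁ → Tst Y ρ₂ → Tst (X ++ Y) ρ
Tst-++⁺ [] {Y} q e h = Tst-resp Y (≋-sym (≋-trans (refineˡ q e) (⊕-identityˡ _))) h
Tst-++⁺ (L ∷ X) q (ρa , _ , q′ , l , h₁) h₂ = ρa , _ , refineˡ-assoc q q′ , l , Tst-++⁺ X (≋-refl _) h₁ h₂

Prom-++⁻ : ∀ {n} (N : Sum n tm) (γs₁ : List D) {γs₂ ρ} → Prom N ρ (γs₁ ++ γs₂) →
  ∃₂ λ ρ₁ ρ₂ → ρ ≋ (ρ₁ ⊕ ρ₂) × Prom N ρ₁ γs₁ × Prom N ρ₂ γs₂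
Prom-++⁻ N [] {ρ = ρ} h = ∅ , ρ , ≋-sym (⊕-identityˡ ρ) , ≋-refl ∅ , h
Prom-++⁻ N (γ ∷ γs₁) (ρa , _ , q , l , h) with Prom-++⁻ N γs₁ h
... | ρ₁ , ρ₂ , q′ , h₁ , h₂ = ρa ⊕ ρ₁ , ρ₂ , refineʳ-assoc q q′ , (ρa , ρ₁ , ≋-refl _ , l , h₁) , h₂

Prom-++⁺ : ∀ {n} (N : Sum n tm) (γs₁ : List D) {γs₂ ρ ρ₁ ρ₂} →
  ρ ≋ (ρ₁ ⊕ ρ₂) → Prom N ρ₁ γs₁ → Prom N ρ₂ γs₂ → Prom N ρ (γs₁ ++ γs₂)
Prom-++⁺ N [] q e h = Prom-resp N (≋-sym (≋-trans (refineˡ q e) (⊕-identityˡ _))) h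
Prom-++⁺ N (γ ∷ γs₁) q (ρa , _ , q′ , l , h₁) h₂ = ρa , _ , refineˡ-assoc q q′ , l , Prom-++⁺ N γs₁ (≋-refl _) h₁ h₂

Prom-perm : ∀ {n} (N : Sum n tm) {γs γs′ ρ} → γs ≈ₘ γs′ → Prom N ρ γs → Prom N ρ γs′
Prom-perm N [] h = h
Prom-perm N (cons b₁ b₂ p q) (ρa , _ , r , l , h) with Prom-++⁻ N b₁ (Prom-perm N q h)
... | ρ₁ , ρ₂ , r′ , h₁ , h₂ =
  Prom-++⁺ N b₁ (refineʳ-swap r r′) h₁ (ρa , ρ₂ , ≋-refl _ , ⟦⟧Σ-resp N (≋-refl _) p l , h₂)

Prom-mono : ∀ {n} {N N′ : Sum n tm} → (∀ {ρ v} → ⟦ N ⟧Σ ρ v → ⟦ N′ ⟧Σ ρ v) → ∀ {ρ} γs → Prom N ρ γs → Prom N′ ρ γs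
Prom-mono f [] h = h
Prom-mono f (γ ∷ γs) (ρ₁ , ρ₂ , q , l , h) = ρ₁ , ρ₂ , q , f l , Prom-mono f γs h

Prom-[-]⁻ : ∀ {n} (N : Sum n tm) {ρ α} → Prom N ρ (α ∷ []) → ⟦ N ⟧Σ ρ α
Prom-[-]⁻ N {α = α} (ρ₁ , _ , q , h , r) = ⟦⟧Σ-resp N (≋-sym (≋-trans (refineʳ q r) (⊕-identityʳ ρ₁))) (≈-refl α) h

Prom-[-]⁺ : ∀ {n} (N : Sum n tm) {ρ α} → ⟦ N ⟧Σ ρ α → Prom N ρ (α ∷ [])
Prom-[-]⁺ N {ρ} h = ρ , ∅ , ≋-sym (⊕-identityʳ ρ) , h , ≋-refl ∅

mutual
  ~-sym : ∀ {n s} {e e′ : Exp n s} → e ~ e′ → e′ ~ e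
  ~-sym var = var
  ~-sym (lam p) = lam (~-sym p)
  ~-sym (app p q) = app (~-sym p) (~-sym q)
  ~-sym (tbar p) = tbar (~-sym p)
  ~-sym (bag p q) = bag (~ₘ-sym p) (~ₛ-sym q)
  ~-sym (test p) = test (~ₘ-sym p)

  ~ₘ-sym : ∀ {n} {Ls Ks : List (Exp n tm)} → Ls ~ₘ Ks → Ks ~ₘ Ls
  ~ₘ-sym [] = []
  ~ₘ-sym (cons Ls₁ Ls₂ p q) = ~ₘ-insert Ls₁ (~ₘ-sym q) (~-sym p)

  ~ₘ-insert : ∀ {n} (Ls₁ : List (Exp n tm)) {Ls₂ Ks L L′} → (Ls₁ ++ Ls₂) ~ₘ Ks → L ~ L′ → (Ls₁ ++ L ∷ Ls₂) ~ₘ (L′ ∷ Ks)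
  ~ₘ-insert [] q p = cons [] _ p q
  ~ₘ-insert (K ∷ Ls₁) (cons c₁ c₂ r q) p = cons (_ ∷ c₁) c₂ r (~ₘ-insert Ls₁ q p)

  ~ₛ-sym : ∀ {n s} {A B : Sum n s} → A ~ₛ B → B ~ₛ A
  ~ₛ-sym (sums f g) = sums (λ m → let e , m′ , p = g m in e , m′ , ~-sym p)
                            (λ m → let e , m′ , p = f m in e , m′ , ~-sym p)

mutual
  ⟦⟧-~ : ∀ {n s} {e e′ : Exp n s} → e ~ e′ → ∀ {ρ v} → ⟦ e ⟧ ρ v → ⟦ e′ ⟧ ρ v
  ⟦⟧-~ var h = h
  ⟦⟧-~ (lam p) (b , β , q , m) = b , β , q , ⟦⟧-~ p m
  ⟦⟧-~ (app p p′) (b , ρ₁ , ρ₂ , q , m , h) = b , ρ₁ , ρ₂ , q , ⟦⟧-~ p m , ⟦⟧-~ p′ h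
  ⟦⟧-~ (tbar p) (q , h) = q , ⟦⟧-~ p h
  ⟦⟧-~ (bag p p′) (ρ₁ , ρ₂ , βs , γs , q , l , h , w) with Lin-~ₘ p l
  ... | βs′ , e , l′ = ρ₁ , ρ₂ , βs′ , γs , q , l′ , Prom-mono (⟦⟧Σ-~ₛ p′) γs h , ≈ₘ-trans w (≈ₘ-++ e (≈ₘ-refl γs))
  ⟦⟧-~ (test p) h = Tst-~ₘ p h

  ⟦⟧Σ-~ₛ : ∀ {n s} {A B : Sum n s} → A ~ₛ B → ∀ {ρ v} → ⟦ A ⟧Σ ρ v → ⟦ B ⟧Σ ρ v
  ⟦⟧Σ-~ₛ (sums f g) h with ⟦⟧Σ-find h
  ... | e , m , h′ with f m
  ... | e′ , m′ , p = ⟦⟧Σ-lose m′ (⟦⟧-~ p h′)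

  Lin-~ₘ : ∀ {n} {Ls Ls′ : List (Exp n tm)} → Ls ~ₘ Ls′ → ∀ {ρ βs} → Lin Ls ρ βs → ∃ λ βs′ → βs ≈ₘ βs′ × Lin Ls′ ρ βs′
  Lin-~ₘ [] {βs = βs} h = βs , ≈ₘ-refl βs , h
  Lin-~ₘ (cons Ls₁ Ls₂ p r) (β , _ , ρa , _ , refl , q , l , lr) with Lin-~ₘ r lr
  ... | δs , e , lδ with Lin-++⁻ Ls₁ lδ
  ... | δ₁ , δ₂ , ρ₁ , ρ₂ , refl , q′ , h₁ , h₂ =
    δ₁ ++ β ∷ δ₂ , cons δ₁ δ₂ (≈-refl β) e ,
    Lin-++⁺ Ls₁ (refineʳ-swap q q′) h₁ (β , δ₂ , ρa , ρ₂ , refl , ≋-refl _ , ⟦⟧-~ p l , h₂)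

  Tst-~ₘ : ∀ {n} {Ls Ls′ : List (Exp n tm)} → Ls ~ₘ Ls′ → ∀ {ρ} → Tst Ls ρ → Tst Ls′ ρ
  Tst-~ₘ [] h = h
  Tst-~ₘ (cons Ls₁ Ls₂ p r) (ρa , _ , q , l , lr) with Tst-++⁻ Ls₁ (Tst-~ₘ r lr)
  ... | ρ₁ , ρ₂ , q′ , h₁ , h₂ = Tst-++⁺ Ls₁ (refineʳ-swap q q′) h₁ (ρa , ρ₂ , ≋-refl _ , ⟦⟧-~ p l , h₂)

-- Renaming and weakening

at : ∀ {n} → Fin n → List D → Env n
at i a = ∅ [ i ]≔ a

at-[] : ∀ {n} (i : Fin n) → at i [] ≋ ∅
at-[] zero = ≋-refl _
at-[] (suc i) = [] ∷ at-[] i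

at-++ : ∀ {n} (i : Fin n) a b → at i (a ++ b) ≋ (at i a ⊕ at i b)
at-++ zero a b = ≈ₘ-refl _ ∷ ≋-sym (⊕-identityˡ ∅)
at-++ (suc i) a b = [] ∷ at-++ i a b

at-cong : ∀ {n} (i : Fin n) {a b} → a ≈ₘ b → at i a ≋ at i b
at-cong zero p = p ∷ ≋-refl _
at-cong (suc i) p = [] ∷ at-cong i p

push : ∀ {n m} → (Fin n → Fin m) → Env n → Env m
push f [] = ∅
push f (a ∷ ρ) = at (f zero) a ⊕ push (λ i → f (suc i)) ρ

push-∅ : ∀ {n m} (f : Fin n → Fin m) → push f ∅ ≋ ∅
push-∅ {zero} f = ≋-refl _
push-∅ {suc n} f = ≋-trans (⊕-cong (at-[] (f zero)) (push-∅ (λ i → f (suc i)))) (⊕-identityˡ ∅)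

push-⊕ : ∀ {n m} (f : Fin n → Fin m) (ρ₁ ρ₂ : Env n) → push f (ρ₁ ⊕ ρ₂) ≋ (push f ρ₁ ⊕ push f ρ₂)
push-⊕ f [] [] = ≋-sym (⊕-identityˡ ∅)
push-⊕ f (a ∷ ρ₁) (b ∷ ρ₂) = ≋-trans (⊕-cong (at-++ (f zero) a b) (push-⊕ (λ i → f (suc i)) ρ₁ ρ₂))
  (interchange (at (f zero) a) (at (f zero) b) (push (λ i → f (suc i)) ρ₁) (push (λ i → f (suc i)) ρ₂))

push-cong : ∀ {n m} (f : Fin n → Fin m) {ρ ρ′ : Env n} → ρ ≋ ρ′ → push f ρ ≋ push f ρ′
push-cong f [] = ≋-refl _
push-cong f (p ∷ q) = ⊕-cong (at-cong (f zero) p) (push-cong (λ i → f (suc i)) q)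

push-at : ∀ {n m} (f : Fin n → Fin m) (i : Fin n) a → push f (at i a) ≋ at (f i) a
push-at f zero a = ≋-trans (⊕-cong (≋-refl _) (push-∅ (λ i → f (suc i)))) (⊕-identityʳ _)
push-at f (suc i) a = ≋-trans (⊕-cong (at-[] (f zero)) (push-at (λ i → f (suc i)) i a)) (⊕-identityˡ _)

push-suc : ∀ {n m} (f : Fin n → Fin m) (ρ : Env n) → push (λ i → suc (f i)) ρ ≋ ([] ∷ push f ρ)
push-suc f [] = ≋-refl _
push-suc f (a ∷ ρ) = ⊕-cong (≋-refl _) (push-suc (λ i → f (suc i)) ρ)

push-ext : ∀ {n m} (f : Fin n → Fin m) c (ρ : Env n) → push (ext f) (c ∷ ρ) ≋ (c ∷ push f ρ)
push-ext f c ρ = ≋-trans (⊕-cong (≋-refl _) (push-suc f ρ)) (≈ₘ-++-identityʳ c ∷ ⊕-identityˡ _)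

push-id : ∀ {n} (ρ : Env n) → push (λ i → i) ρ ≋ ρ
push-id [] = ≋-refl _
push-id (a ∷ ρ) =
  ≋-trans (⊕-cong (≋-refl _) (≋-trans (push-suc (λ i → i) ρ) ([] ∷ push-id ρ))) (≈ₘ-++-identityʳ a ∷ ⊕-identityˡ ρ)

push-split : ∀ {n m} (f : Fin n → Fin m) {ρ ρ′ ρ₁ ρ₂} → ρ ≋ push f ρ′ → ρ′ ≋ (ρ₁ ⊕ ρ₂) → ρ ≋ (push f ρ₁ ⊕ push f ρ₂)
push-split f {ρ₁ = ρ₁} {ρ₂} p q = ≋-trans p (≋-trans (push-cong f q) (push-⊕ f ρ₁ ρ₂))

push-join : ∀ {n m} (f : Fin n → Fin m) {ρ ρ₁ ρ₂ σ₁ σ₂} →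
  ρ ≋ (ρ₁ ⊕ ρ₂) → ρ₁ ≋ push f σ₁ → ρ₂ ≋ push f σ₂ → ρ ≋ push f (σ₁ ⊕ σ₂)
push-join f {σ₁ = σ₁} {σ₂} p q r = ≋-trans p (≋-trans (⊕-cong q r) (≋-sym (push-⊕ f σ₁ σ₂)))

push-≋∅ : ∀ {n m} (f : Fin n → Fin m) {ρ ρ′} → ρ ≋ push f ρ′ → ρ′ ≋ ∅ → ρ ≋ ∅
push-≋∅ f p q = ≋-trans p (≋-trans (push-cong f q) (push-∅ f))

mutual
  ⟦ren⟧⁻ : ∀ {n m s} (f : Fin n → Fin m) (e : Exp n s) {ρ v} → ⟦ ren f e ⟧ ρ v → ∃ λ ρ′ → ρ ≋ push f ρ′ × ⟦ e ⟧ ρ′ v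
  ⟦ren⟧⁻ f (var i) {v = α} h = single i α , ≋-trans h (≋-sym (push-at f i (α ∷ []))) , ≋-refl _
  ⟦ren⟧⁻ f (lam M) (b , β , q , m) with ⟦ren⟧⁻ (ext f) M m
  ... | c ∷ ρ′ , e , m′ with ≋-trans e (push-ext f c ρ′)
  ... | p ∷ r = ρ′ , r , c , β , ≈-trans q (::-congˡ β p) , m′
  ⟦ren⟧⁻ f (app M P) (b , _ , _ , q , m , h) with ⟦ren⟧⁻ f M m | ⟦ren⟧⁻ f P h
  ... | ρ₁′ , e₁ , m′ | ρ₂′ , e₂ , h′ = ρ₁′ ⊕ ρ₂′ , push-join f {σ₁ = ρ₁′} {ρ₂′} q e₁ e₂ , b , ρ₁′ , ρ₂′ , ≋-refl _ , m′ , h′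
  ⟦ren⟧⁻ f (tbar V) (q , h) with ⟦ren⟧⁻ f V h
  ... | ρ′ , e , h′ = ρ′ , e , q , h′
  ⟦ren⟧⁻ f (bag Ls N) (_ , _ , βs , γs , q , l , h , w) with Lin-ren⁻ f Ls l | Prom-ren⁻ f N γs h
  ... | ρ₁′ , e₁ , l′ | ρ₂′ , e₂ , h′ = ρ₁′ ⊕ ρ₂′ , push-join f {σ₁ = ρ₁′} {ρ₂′} q e₁ e₂ , ρ₁′ , ρ₂′ , βs , γs , ≋-refl _ , l′ , h′ , w
  ⟦ren⟧⁻ f (test Ls) h = Tst-ren⁻ f Ls h

  Lin-ren⁻ : ∀ {n m} (f : Fin n → Fin m) (Ls : List (Exp n tm)) {ρ βs} → Lin (renL f Ls) ρ βs → ∃ λ ρ′ → ρ ≋ push f ρ′ × Lin Ls ρ′ βs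
  Lin-ren⁻ f [] (q , e) = ∅ , ≋-trans q (≋-sym (push-∅ f)) , ≋-refl _ , e
  Lin-ren⁻ f (L ∷ Ls) (β , βs , _ , _ , e , q , l , r) with ⟦ren⟧⁻ f L l | Lin-ren⁻ f Ls r
  ... | ρ₁′ , e₁ , l′ | ρ₂′ , e₂ , r′ = ρ₁′ ⊕ ρ₂′ , push-join f {σ₁ = ρ₁′} {ρ₂′} q e₁ e₂ , β , βs , ρ₁′ , ρ₂′ , e , ≋-refl _ , l′ , r′

  Tst-ren⁻ : ∀ {n m} (f : Fin n → Fin m) (Ls : List (Exp n tm)) {ρ} → Tst (renL f Ls) ρ → ∃ λ ρ′ → ρ ≋ push f ρ′ × Tst Ls ρ′
  Tst-ren⁻ f [] q = ∅ , ≋-trans q (≋-sym (push-∅ f)) , ≋-refl _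
  Tst-ren⁻ f (L ∷ Ls) (_ , _ , q , l , r) with ⟦ren⟧⁻ f L l | Tst-ren⁻ f Ls r
  ... | ρ₁′ , e₁ , l′ | ρ₂′ , e₂ , r′ = ρ₁′ ⊕ ρ₂′ , push-join f {σ₁ = ρ₁′} {ρ₂′} q e₁ e₂ , ρ₁′ , ρ₂′ , ≋-refl _ , l′ , r′

  ⟦renL⟧Σ⁻ : ∀ {n m} (f : Fin n → Fin m) (N : List (Exp n tm)) {ρ v} → ⟦ renL f N ⟧Σ ρ v → ∃ λ ρ′ → ρ ≋ push f ρ′ × ⟦ N ⟧Σ ρ′ v
  ⟦renL⟧Σ⁻ f (e ∷ N) (inj₁ h) with ⟦ren⟧⁻ f e h
  ... | ρ′ , q , h′ = ρ′ , q , inj₁ h′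
  ⟦renL⟧Σ⁻ f (e ∷ N) (inj₂ h) with ⟦renL⟧Σ⁻ f N h
  ... | ρ′ , q , h′ = ρ′ , q , inj₂ h′

  Prom-ren⁻ : ∀ {n m} (f : Fin n → Fin m) (N : List (Exp n tm)) γs {ρ} → Prom (renL f N) ρ γs → ∃ λ ρ′ → ρ ≋ push f ρ′ × Prom N ρ′ γs
  Prom-ren⁻ f N [] q = ∅ , ≋-trans q (≋-sym (push-∅ f)) , ≋-refl _
  Prom-ren⁻ f N (γ ∷ γs) (_ , _ , q , l , r) with ⟦renL⟧Σ⁻ f N l | Prom-ren⁻ f N γs r
  ... | ρ₁′ , e₁ , l′ | ρ₂′ , e₂ , r′ = ρ₁′ ⊕ ρ₂′ , push-join f {σ₁ = ρ₁′} {ρ₂′} q e₁ e₂ , ρ₁′ , ρ₂′ , ≋-refl _ , l′ , r′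

mutual
  ⟦ren⟧⁺ : ∀ {n m s} (f : Fin n → Fin m) (e : Exp n s) {ρ ρ′ v} → ρ ≋ push f ρ′ → ⟦ e ⟧ ρ′ v → ⟦ ren f e ⟧ ρ v
  ⟦ren⟧⁺ f (var i) {v = α} p h = ≋-trans p (≋-trans (push-cong f h) (push-at f i (α ∷ [])))
  ⟦ren⟧⁺ f (lam M) {ρ′ = ρ′} p (b , β , q , m) =
    b , β , q , ⟦ren⟧⁺ (ext f) M (≋-trans (≈ₘ-refl b ∷ p) (≋-sym (push-ext f b ρ′))) m
  ⟦ren⟧⁺ f (app M P) p (b , _ , _ , q , m , h) = b , _ , _ , push-split f p q , ⟦ren⟧⁺ f M (≋-refl _) m , ⟦ren⟧⁺ f P (≋-refl _) h
  ⟦ren⟧⁺ f (tbar V) p (q , h) = q , ⟦ren⟧⁺ f V p h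
  ⟦ren⟧⁺ f (bag Ls N) p (_ , _ , βs , γs , q , l , h , w) =
    _ , _ , βs , γs , push-split f p q , Lin-ren⁺ f Ls (≋-refl _) l , Prom-ren⁺ f N γs (≋-refl _) h , w
  ⟦ren⟧⁺ f (test Ls) p h = Tst-ren⁺ f Ls p h

  Lin-ren⁺ : ∀ {n m} (f : Fin n → Fin m) (Ls : List (Exp n tm)) {ρ ρ′ βs} → ρ ≋ push f ρ′ → Lin Ls ρ′ βs → Lin (renL f Ls) ρ βs
  Lin-ren⁺ f [] p (q , e) = push-≋∅ f p q , e
  Lin-ren⁺ f (L ∷ Ls) p (β , βs , _ , _ , e , q , l , r) =
    β , βs , _ , _ , e , push-split f p q , ⟦ren⟧⁺ f L (≋-refl _) l , Lin-ren⁺ f Ls (≋-refl _) r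

  Tst-ren⁺ : ∀ {n m} (f : Fin n → Fin m) (Ls : List (Exp n tm)) {ρ ρ′} → ρ ≋ push f ρ′ → Tst Ls ρ′ → Tst (renL f Ls) ρ
  Tst-ren⁺ f [] p q = push-≋∅ f p q
  Tst-ren⁺ f (L ∷ Ls) p (_ , _ , q , l , r) = _ , _ , push-split f p q , ⟦ren⟧⁺ f L (≋-refl _) l , Tst-ren⁺ f Ls (≋-refl _) r

  ⟦renL⟧Σ⁺ : ∀ {n m} (f : Fin n → Fin m) (N : List (Exp n tm)) {ρ ρ′ v} → ρ ≋ push f ρ′ → ⟦ N ⟧Σ ρ′ v → ⟦ renL f N ⟧Σ ρ v
  ⟦renL⟧Σ⁺ f (e ∷ N) p (inj₁ h) = inj₁ (⟦ren⟧⁺ f e p h)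
  ⟦renL⟧Σ⁺ f (e ∷ N) p (inj₂ h) = inj₂ (⟦renL⟧Σ⁺ f N p h)

  Prom-ren⁺ : ∀ {n m} (f : Fin n → Fin m) (N : List (Exp n tm)) γs {ρ ρ′} → ρ ≋ push f ρ′ → Prom N ρ′ γs → Prom (renL f N) ρ γs
  Prom-ren⁺ f N [] p q = push-≋∅ f p q
  Prom-ren⁺ f N (γ ∷ γs) p (_ , _ , q , l , r) = _ , _ , push-split f p q , ⟦renL⟧Σ⁺ f N (≋-refl _) l , Prom-ren⁺ f N γs (≋-refl _) r

push-suc-id : ∀ {n} (ρ : Env n) → push suc ρ ≋ ([] ∷ ρ)
push-suc-id ρ = ≋-trans (push-suc (λ i → i) ρ) ([] ∷ push-id ρ)

⟦weaken⟧⁻ : ∀ {n s} (e : Exp n s) {a ρ v} → ⟦ weaken e ⟧ (a ∷ ρ) v → a ≡ [] × ⟦ e ⟧ ρ v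
⟦weaken⟧⁻ e {v = v} h with ⟦ren⟧⁻ suc e h
... | ρ′ , q , h′ with ≋-trans q (push-suc-id ρ′)
... | p ∷ r = ≈ₘ-[]ʳ p , ⟦⟧-resp e (≋-sym r) (≈ᵥ-refl v) h′

⟦weaken⟧⁺ : ∀ {n s} (e : Exp n s) {ρ v} → ⟦ e ⟧ ρ v → ⟦ weaken e ⟧ ([] ∷ ρ) v
⟦weaken⟧⁺ e {ρ} h = ⟦ren⟧⁺ suc e (≋-sym (push-suc-id ρ)) h

⟦map-weaken⟧Σ⁻ : ∀ {n s} (N : Sum n s) {a ρ v} → ⟦ map weaken N ⟧Σ (a ∷ ρ) v → a ≡ [] × ⟦ N ⟧Σ ρ v
⟦map-weaken⟧Σ⁻ (e ∷ N) (inj₁ h) = map₂ inj₁ (⟦weaken⟧⁻ e h)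
⟦map-weaken⟧Σ⁻ (e ∷ N) (inj₂ h) = map₂ inj₂ (⟦map-weaken⟧Σ⁻ N h)

⟦map-weaken⟧Σ⁺ : ∀ {n s} (N : Sum n s) {ρ v} → ⟦ N ⟧Σ ρ v → ⟦ map weaken N ⟧Σ ([] ∷ ρ) v
⟦map-weaken⟧Σ⁺ (e ∷ N) (inj₁ h) = inj₁ (⟦weaken⟧⁺ e h)
⟦map-weaken⟧Σ⁺ (e ∷ N) (inj₂ h) = inj₂ (⟦map-weaken⟧Σ⁺ N h)

Prom-weaken⁻ : ∀ {n} (N : Sum n tm) γs {a ρ} → Prom (map weaken N) (a ∷ ρ) γs → a ≡ [] × Prom N ρ γs
Prom-weaken⁻ N [] (p ∷ q) = ≈ₘ-[]ʳ p , q
Prom-weaken⁻ N (γ ∷ γs) (_ ∷ ρ₁ , _ ∷ ρ₂ , p ∷ q , l , r) with ⟦map-weaken⟧Σ⁻ N l | Prom-weaken⁻ N γs r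
... | refl , l′ | refl , r′ = ≈ₘ-[]ʳ p , ρ₁ , ρ₂ , q , l′ , r′

Prom-weaken⁺ : ∀ {n} (N : Sum n tm) γs {ρ} → Prom N ρ γs → Prom (map weaken N) ([] ∷ ρ) γs
Prom-weaken⁺ N [] q = [] ∷ q
Prom-weaken⁺ N (γ ∷ γs) (ρ₁ , ρ₂ , q , l , r) = [] ∷ ρ₁ , [] ∷ ρ₂ , [] ∷ q , ⟦map-weaken⟧Σ⁺ N l , Prom-weaken⁺ N γs r

Prom-var⁻ : ∀ {n} (i : Fin n) a {ρ} → Prom (var i ∷ []) ρ a → ρ ≋ at i a
Prom-var⁻ i [] q = ≋-trans q (≋-sym (at-[] i))
Prom-var⁻ i (γ ∷ a) (_ , _ , q , inj₁ h , r) =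
  ≋-trans q (≋-trans (⊕-cong h (Prom-var⁻ i a r)) (≋-sym (at-++ i (γ ∷ []) a)))

Prom-var⁺ : ∀ {n} (i : Fin n) a {ρ} → ρ ≋ at i a → Prom (var i ∷ []) ρ a
Prom-var⁺ i [] q = ≋-trans q (at-[] i)
Prom-var⁺ i (γ ∷ a) q = at i (γ ∷ []) , at i a , ≋-trans q (at-++ i (γ ∷ []) a) , inj₁ (≋-refl _) , Prom-var⁺ i a (≋-refl _)

-- Substitution

-- SubstEnv σ ρ′ ρ: ρ splits into one part per variable i, the i-th
-- realising the multiset ρ′ i as a promotion of σ i.  This is how an
-- environment ρ′ of A becomes an environment ρ of A{σ}.
SubstEnv : ∀ {n m} → (Fin n → Sum m tm) → Env n → Env m → Set
SubstEnv σ [] ρ = ρ ≋ ∅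
SubstEnv σ (a ∷ ρ′) ρ = ∃₂ λ ρ₁ ρ₂ → ρ ≋ (ρ₁ ⊕ ρ₂) × Prom (σ zero) ρ₁ a × SubstEnv (λ i → σ (suc i)) ρ′ ρ₂

SubstEnv-respʳ : ∀ {n m} (σ : Fin n → Sum m tm) (ρ′ : Env n) {ρ ρ~} → ρ ≋ ρ~ → SubstEnv σ ρ′ ρ → SubstEnv σ ρ′ ρ~
SubstEnv-respʳ σ [] p h = ≋-trans (≋-sym p) h
SubstEnv-respʳ σ (a ∷ ρ′) p (ρ₁ , ρ₂ , q , h , r) = ρ₁ , ρ₂ , ≋-trans (≋-sym p) q , h , r

SubstEnv-respˡ : ∀ {n m} (σ : Fin n → Sum m tm) {ρ′ ρ″ : Env n} {ρ} → ρ′ ≋ ρ″ → SubstEnv σ ρ′ ρ → SubstEnv σ ρ″ ρ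
SubstEnv-respˡ σ [] h = h
SubstEnv-respˡ σ (p ∷ ps) (ρ₁ , ρ₂ , q , h , r) = ρ₁ , ρ₂ , q , Prom-perm (σ zero) p h , SubstEnv-respˡ (λ i → σ (suc i)) ps r

SubstEnv-∅⁻ : ∀ {n m} (σ : Fin n → Sum m tm) {ρ} → SubstEnv σ ∅ ρ → ρ ≋ ∅
SubstEnv-∅⁻ {zero} σ h = h
SubstEnv-∅⁻ {suc n} σ (_ , _ , q , h , r) =
  ≋-trans q (≋-trans (⊕-cong h (SubstEnv-∅⁻ (λ i → σ (suc i)) r)) (⊕-identityˡ ∅))

SubstEnv-∅⁺ : ∀ {n m} (σ : Fin n → Sum m tm) {ρ} → ρ ≋ ∅ → SubstEnv σ ∅ ρ
SubstEnv-∅⁺ {zero} σ h = h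
SubstEnv-∅⁺ {suc n} σ h = ∅ , ∅ , ≋-trans h (≋-sym (⊕-identityˡ ∅)) , ≋-refl ∅ , SubstEnv-∅⁺ (λ i → σ (suc i)) (≋-refl ∅)

SubstEnv-⊕⁻ : ∀ {n m} (σ : Fin n → Sum m tm) (ρ₁′ ρ₂′ : Env n) {ρ} → SubstEnv σ (ρ₁′ ⊕ ρ₂′) ρ →
  ∃₂ λ ρ₁ ρ₂ → ρ ≋ (ρ₁ ⊕ ρ₂) × SubstEnv σ ρ₁′ ρ₁ × SubstEnv σ ρ₂′ ρ₂
SubstEnv-⊕⁻ σ [] [] h = ∅ , ∅ , ≋-trans h (≋-sym (⊕-identityˡ ∅)) , ≋-refl ∅ , ≋-refl ∅
SubstEnv-⊕⁻ σ (a ∷ ρ₁′) (b ∷ ρ₂′) (_ , _ , q , h , r)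
  with Prom-++⁻ (σ zero) a h | SubstEnv-⊕⁻ (λ i → σ (suc i)) ρ₁′ ρ₂′ r
... | τ₁ , τ₂ , q₁ , h₁ , h₂ | κ₁ , κ₂ , q₂ , r₁ , r₂ =
  τ₁ ⊕ κ₁ , τ₂ ⊕ κ₂ , ≋-trans q (≋-trans (⊕-cong q₁ q₂) (interchange τ₁ τ₂ κ₁ κ₂)) ,
  (τ₁ , κ₁ , ≋-refl _ , h₁ , r₁) , (τ₂ , κ₂ , ≋-refl _ , h₂ , r₂)

SubstEnv-⊕⁺ : ∀ {n m} (σ : Fin n → Sum m tm) (ρ₁′ ρ₂′ : Env n) {ρ ρ₁ ρ₂} →
  ρ ≋ (ρ₁ ⊕ ρ₂) → SubstEnv σ ρ₁′ ρ₁ → SubstEnv σ ρ₂′ ρ₂ → SubstEnv σ (ρ₁′ ⊕ ρ₂′) ρ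
SubstEnv-⊕⁺ σ [] [] q h₁ h₂ = ≋-trans q (≋-trans (⊕-cong h₁ h₂) (⊕-identityˡ ∅))
SubstEnv-⊕⁺ σ (a ∷ ρ₁′) (b ∷ ρ₂′) q (τ₁ , κ₁ , q₁ , h₁ , r₁) (τ₂ , κ₂ , q₂ , h₂ , r₂) =
  τ₁ ⊕ τ₂ , κ₁ ⊕ κ₂ , ≋-trans q (≋-trans (⊕-cong q₁ q₂) (interchange τ₁ κ₁ τ₂ κ₂)) ,
  Prom-++⁺ (σ zero) a (≋-refl _) h₁ h₂ , SubstEnv-⊕⁺ (λ i → σ (suc i)) ρ₁′ ρ₂′ (≋-refl _) r₁ r₂

SubstEnv-single⁻ : ∀ {n m} (σ : Fin n → Sum m tm) (i : Fin n) {ρ α} → SubstEnv σ (single i α) ρ → ⟦ σ i ⟧Σ ρ α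
SubstEnv-single⁻ σ zero {α = α} (ρ₁ , _ , q , h , r) =
  ⟦⟧Σ-resp (σ zero) (≋-sym (≋-trans (refineʳ q (SubstEnv-∅⁻ (λ i → σ (suc i)) r)) (⊕-identityʳ ρ₁))) (≈-refl α)
    (Prom-[-]⁻ (σ zero) h)
SubstEnv-single⁻ σ (suc i) {α = α} (_ , ρ₂ , q , h , r) =
  ⟦⟧Σ-resp (σ (suc i)) (≋-sym (≋-trans (refineˡ q h) (⊕-identityˡ ρ₂))) (≈-refl α) (SubstEnv-single⁻ (λ i → σ (suc i)) i r)

SubstEnv-single⁺ : ∀ {n m} (σ : Fin n → Sum m tm) (i : Fin n) {ρ α} → ⟦ σ i ⟧Σ ρ α → SubstEnv σ (single i α) ρ
SubstEnv-single⁺ σ zero {ρ} h =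
  ρ , ∅ , ≋-sym (⊕-identityʳ ρ) , Prom-[-]⁺ (σ zero) h , SubstEnv-∅⁺ (λ i → σ (suc i)) (≋-refl ∅)
SubstEnv-single⁺ σ (suc i) {ρ} h = ∅ , ρ , ≋-sym (⊕-identityˡ ρ) , ≋-refl ∅ , SubstEnv-single⁺ (λ i → σ (suc i)) i h

SubstEnv-ren⁻ : ∀ {n m} (f : Fin n → Fin m) (ρ′ : Env n) {ρ} → SubstEnv (λ i → var (f i) ∷ []) ρ′ ρ → ρ ≋ push f ρ′
SubstEnv-ren⁻ f [] h = h
SubstEnv-ren⁻ f (a ∷ ρ′) (_ , _ , q , h , r) = ≋-trans q (⊕-cong (Prom-var⁻ (f zero) a h) (SubstEnv-ren⁻ (λ i → f (suc i)) ρ′ r))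

SubstEnv-ren⁺ : ∀ {n m} (f : Fin n → Fin m) (ρ′ : Env n) {ρ} → ρ ≋ push f ρ′ → SubstEnv (λ i → var (f i) ∷ []) ρ′ ρ
SubstEnv-ren⁺ f [] h = h
SubstEnv-ren⁺ f (a ∷ ρ′) h = _ , _ , h , Prom-var⁺ (f zero) a (≋-refl _) , SubstEnv-ren⁺ (λ i → f (suc i)) ρ′ (≋-refl _)

SubstEnv-weaken⁻ : ∀ {n m} (σ : Fin n → Sum m tm) (ρ′ : Env n) {a ρ} →
  SubstEnv (λ i → map weaken (σ i)) ρ′ (a ∷ ρ) → a ≡ [] × SubstEnv σ ρ′ ρ
SubstEnv-weaken⁻ σ [] (p ∷ q) = ≈ₘ-[]ʳ p , q
SubstEnv-weaken⁻ σ (b ∷ ρ′) (_ ∷ ρ₁ , _ ∷ ρ₂ , p ∷ q , h , r)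
  with Prom-weaken⁻ (σ zero) b h | SubstEnv-weaken⁻ (λ i → σ (suc i)) ρ′ r
... | refl , h′ | refl , r′ = ≈ₘ-[]ʳ p , ρ₁ , ρ₂ , q , h′ , r′

SubstEnv-weaken⁺ : ∀ {n m} (σ : Fin n → Sum m tm) (ρ′ : Env n) {ρ} →
  SubstEnv σ ρ′ ρ → SubstEnv (λ i → map weaken (σ i)) ρ′ ([] ∷ ρ)
SubstEnv-weaken⁺ σ [] q = [] ∷ q
SubstEnv-weaken⁺ σ (b ∷ ρ′) (ρ₁ , ρ₂ , q , h , r) =
  [] ∷ ρ₁ , [] ∷ ρ₂ , [] ∷ q , Prom-weaken⁺ (σ zero) b h , SubstEnv-weaken⁺ (λ i → σ (suc i)) ρ′ r

SubstEnv-exts⁻ : ∀ {n m} (σ : Fin n → Sum m tm) c (ρ′ : Env n) {b ρ} →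
  SubstEnv (exts σ) (c ∷ ρ′) (b ∷ ρ) → b ≈ₘ c × SubstEnv σ ρ′ ρ
SubstEnv-exts⁻ σ c ρ′ (_ , _ ∷ ρ₂ , q , h , r) with SubstEnv-weaken⁻ σ ρ′ r
... | refl , r′ with refineˡ q (Prom-var⁻ zero c h)
... | p ∷ q′ = ≈ₘ-trans p (≈ₘ-++-identityʳ c) , SubstEnv-respʳ σ ρ′ (≋-sym (≋-trans q′ (⊕-identityˡ ρ₂))) r′

SubstEnv-exts⁺ : ∀ {n m} (σ : Fin n → Sum m tm) c (ρ′ : Env n) {ρ} → SubstEnv σ ρ′ ρ → SubstEnv (exts σ) (c ∷ ρ′) (c ∷ ρ)
SubstEnv-exts⁺ σ c ρ′ {ρ} h =
  at zero c , [] ∷ ρ , ≈ₘ-sym (≈ₘ-++-identityʳ c) ∷ ≋-sym (⊕-identityˡ ρ) , Prom-var⁺ zero c (≋-refl _) , SubstEnv-weaken⁺ σ ρ′ h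

∈-substList⁺ : ∀ {n m} (σ : Fin n → Sum m tm) L Ls {L′ Ls′} →
  L′ ∈ subst σ L → Ls′ ∈ substList σ Ls → (L′ ∷ Ls′) ∈ substList σ (L ∷ Ls)
∈-substList⁺ σ L Ls {L′} m₁ m₂ = ∈-concatMap⁺ (λ K → map (K ∷_) (substList σ Ls)) (lose m₁ (∈-map⁺ (L′ ∷_) m₂))

∈-substList⁻ : ∀ {n m} (σ : Fin n → Sum m tm) L Ls {Ks} → Ks ∈ substList σ (L ∷ Ls) →
  ∃₂ λ L′ Ls′ → Ks ≡ L′ ∷ Ls′ × L′ ∈ subst σ L × Ls′ ∈ substList σ Ls
∈-substList⁻ σ L Ls m with find (∈-concatMap⁻ (λ L′ → map (L′ ∷_) (substList σ Ls)) {xs = subst σ L} m)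
... | L′ , m₁ , m₂ with ∈-map⁻ (L′ ∷_) m₂
... | Ls′ , m₃ , refl = L′ , Ls′ , refl , m₁ , m₃

mutual
  ⟦subst⟧⁻ : ∀ {n m s} (σ : Fin n → Sum m tm) (e : Exp n s) {ρ v} → ⟦ subst σ e ⟧Σ ρ v →
    ∃ λ ρ′ → ⟦ e ⟧ ρ′ v × SubstEnv σ ρ′ ρ
  ⟦subst⟧⁻ σ (var i) {v = α} h = single i α , ≋-refl _ , SubstEnv-single⁺ σ i h
  ⟦subst⟧⁻ σ (lam M) h with ⟦⟧Σ-map⁻ lam (subst (exts σ) M) h
  ... | _ , mM , (b , β , q , m) with ⟦subst⟧⁻ (exts σ) M (⟦⟧Σ-lose mM m)
  ... | c ∷ ρ′ , m′ , se with SubstEnv-exts⁻ σ c ρ′ se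
  ... | bc , se′ = ρ′ , (c , β , ≈-trans q (::-congˡ β bc) , m′) , se′
  ⟦subst⟧⁻ σ (app M P) h with ⟦⟧Σ-concatMap⁻ (λ M′ → map (app M′) (subst σ P)) (subst σ M) h
  ... | M′ , mM , h′ with ⟦⟧Σ-map⁻ (app M′) (subst σ P) h′
  ... | _ , mP , (b , _ , _ , q , hm , hp) with ⟦subst⟧⁻ σ M (⟦⟧Σ-lose mM hm) | ⟦subst⟧⁻ σ P (⟦⟧Σ-lose mP hp)
  ... | ρ₁′ , hm′ , se₁ | ρ₂′ , hp′ , se₂ =
    ρ₁′ ⊕ ρ₂′ , (b , ρ₁′ , ρ₂′ , ≋-refl _ , hm′ , hp′) , SubstEnv-⊕⁺ σ ρ₁′ ρ₂′ q se₁ se₂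
  ⟦subst⟧⁻ σ (tbar V) h with ⟦⟧Σ-map⁻ tbar (subst σ V) h
  ... | _ , mV , (q , hv) with ⟦subst⟧⁻ σ V (⟦⟧Σ-lose mV hv)
  ... | ρ′ , hv′ , se = ρ′ , (q , hv′) , se
  ⟦subst⟧⁻ σ (bag Ls N) h with ⟦⟧Σ-map⁻ (λ Ls′ → bag Ls′ (substSum σ N)) (substList σ Ls) h
  ... | _ , mL , (_ , _ , βs , γs , q , l , p , w) with Lin-subst⁻ σ Ls mL l | Prom-subst⁻ σ N γs p
  ... | ρ₁′ , l′ , se₁ | ρ₂′ , p′ , se₂ =
    ρ₁′ ⊕ ρ₂′ , (ρ₁′ , ρ₂′ , βs , γs , ≋-refl _ , l′ , p′ , w) , SubstEnv-⊕⁺ σ ρ₁′ ρ₂′ q se₁ se₂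
  ⟦subst⟧⁻ σ (test Ls) h with ⟦⟧Σ-map⁻ test (substList σ Ls) h
  ... | _ , mL , t = Tst-subst⁻ σ Ls mL t

  Lin-subst⁻ : ∀ {n m} (σ : Fin n → Sum m tm) (Ls : List (Exp n tm)) {Ls′ ρ βs} → Ls′ ∈ substList σ Ls → Lin Ls′ ρ βs →
    ∃ λ ρ′ → Lin Ls ρ′ βs × SubstEnv σ ρ′ ρ
  Lin-subst⁻ σ [] (here refl) (q , e) = ∅ , (≋-refl ∅ , e) , SubstEnv-∅⁺ σ q
  Lin-subst⁻ σ (L ∷ Ls) mL l with ∈-substList⁻ σ L Ls mL | l
  ... | _ , _ , refl , m₁ , m₂ | β , βs , _ , _ , refl , q , hl , hr with ⟦subst⟧⁻ σ L (⟦⟧Σ-lose m₁ hl) | Lin-subst⁻ σ Ls m₂ hr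
  ... | ρ₁′ , hl′ , se₁ | ρ₂′ , hr′ , se₂ =
    ρ₁′ ⊕ ρ₂′ , (β , βs , ρ₁′ , ρ₂′ , refl , ≋-refl _ , hl′ , hr′) , SubstEnv-⊕⁺ σ ρ₁′ ρ₂′ q se₁ se₂

  Tst-subst⁻ : ∀ {n m} (σ : Fin n → Sum m tm) (Ls : List (Exp n tm)) {Ls′ ρ} → Ls′ ∈ substList σ Ls → Tst Ls′ ρ →
    ∃ λ ρ′ → Tst Ls ρ′ × SubstEnv σ ρ′ ρ
  Tst-subst⁻ σ [] (here refl) q = ∅ , ≋-refl ∅ , SubstEnv-∅⁺ σ q
  Tst-subst⁻ σ (L ∷ Ls) mL t with ∈-substList⁻ σ L Ls mL | t
  ... | _ , _ , refl , m₁ , m₂ | _ , _ , q , hl , hr with ⟦subst⟧⁻ σ L (⟦⟧Σ-lose m₁ hl) | Tst-subst⁻ σ Ls m₂ hr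
  ... | ρ₁′ , hl′ , se₁ | ρ₂′ , hr′ , se₂ =
    ρ₁′ ⊕ ρ₂′ , (ρ₁′ , ρ₂′ , ≋-refl _ , hl′ , hr′) , SubstEnv-⊕⁺ σ ρ₁′ ρ₂′ q se₁ se₂

  ⟦substSum⟧⁻ : ∀ {n m} (σ : Fin n → Sum m tm) (N : Sum n tm) {ρ v} → ⟦ substSum σ N ⟧Σ ρ v →
    ∃ λ ρ′ → ⟦ N ⟧Σ ρ′ v × SubstEnv σ ρ′ ρ
  ⟦substSum⟧⁻ σ (e ∷ N) h with ⟦⟧Σ-++⁻ (subst σ e) h
  ... | inj₁ h′ with ⟦subst⟧⁻ σ e h′
  ... | ρ′ , h″ , se = ρ′ , inj₁ h″ , se
  ⟦substSum⟧⁻ σ (e ∷ N) h | inj₂ h′ with ⟦substSum⟧⁻ σ N h′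
  ... | ρ′ , h″ , se = ρ′ , inj₂ h″ , se

  Prom-subst⁻ : ∀ {n m} (σ : Fin n → Sum m tm) (N : Sum n tm) γs {ρ} → Prom (substSum σ N) ρ γs →
    ∃ λ ρ′ → Prom N ρ′ γs × SubstEnv σ ρ′ ρ
  Prom-subst⁻ σ N [] q = ∅ , ≋-refl ∅ , SubstEnv-∅⁺ σ q
  Prom-subst⁻ σ N (γ ∷ γs) (_ , _ , q , h , r) with ⟦substSum⟧⁻ σ N h | Prom-subst⁻ σ N γs r
  ... | ρ₁′ , h′ , se₁ | ρ₂′ , r′ , se₂ =
    ρ₁′ ⊕ ρ₂′ , (ρ₁′ , ρ₂′ , ≋-refl _ , h′ , r′) , SubstEnv-⊕⁺ σ ρ₁′ ρ₂′ q se₁ se₂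

mutual
  ⟦subst⟧⁺ : ∀ {n m s} (σ : Fin n → Sum m tm) (e : Exp n s) {ρ ρ′ v} → ⟦ e ⟧ ρ′ v → SubstEnv σ ρ′ ρ → ⟦ subst σ e ⟧Σ ρ v
  ⟦subst⟧⁺ σ (var i) h se = SubstEnv-single⁻ σ i (SubstEnv-respˡ σ h se)
  ⟦subst⟧⁺ σ (lam M) {ρ′ = ρ′} (b , β , q , m) se with ⟦⟧Σ-find (⟦subst⟧⁺ (exts σ) M m (SubstEnv-exts⁺ σ b ρ′ se))
  ... | _ , me , h = ⟦⟧Σ-map⁺ lam me (b , β , q , h)
  ⟦subst⟧⁺ σ (app M P) (b , ρ₁′ , ρ₂′ , q , hm , hp) se with SubstEnv-⊕⁻ σ ρ₁′ ρ₂′ (SubstEnv-respˡ σ q se)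
  ... | ρ₁ , ρ₂ , q′ , se₁ , se₂ with ⟦⟧Σ-find (⟦subst⟧⁺ σ M hm se₁) | ⟦⟧Σ-find (⟦subst⟧⁺ σ P hp se₂)
  ... | M′ , mM , hm′ | _ , mP , hp′ =
    ⟦⟧Σ-concatMap⁺ (λ M′ → map (app M′) (subst σ P)) mM (⟦⟧Σ-map⁺ (app M′) mP (b , ρ₁ , ρ₂ , q′ , hm′ , hp′))
  ⟦subst⟧⁺ σ (tbar V) (q , hv) se with ⟦⟧Σ-find (⟦subst⟧⁺ σ V hv se)
  ... | _ , mV , hv′ = ⟦⟧Σ-map⁺ tbar mV (q , hv′)
  ⟦subst⟧⁺ σ (bag Ls N) (ρ₁′ , ρ₂′ , βs , γs , q , l , p , w) se with SubstEnv-⊕⁻ σ ρ₁′ ρ₂′ (SubstEnv-respˡ σ q se)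
  ... | ρ₁ , ρ₂ , q′ , se₁ , se₂ with Lin-subst⁺ σ Ls l se₁
  ... | _ , mL , l′ =
    ⟦⟧Σ-map⁺ (λ Ls′ → bag Ls′ (substSum σ N)) mL (ρ₁ , ρ₂ , βs , γs , q′ , l′ , Prom-subst⁺ σ N γs p se₂ , w)
  ⟦subst⟧⁺ σ (test Ls) t se with Tst-subst⁺ σ Ls t se
  ... | _ , mL , t′ = ⟦⟧Σ-map⁺ test mL t′

  Lin-subst⁺ : ∀ {n m} (σ : Fin n → Sum m tm) (Ls : List (Exp n tm)) {ρ ρ′ βs} → Lin Ls ρ′ βs → SubstEnv σ ρ′ ρ →
    ∃ λ Ls′ → Ls′ ∈ substList σ Ls × Lin Ls′ ρ βs
  Lin-subst⁺ σ [] (q , e) se = [] , here refl , SubstEnv-∅⁻ σ (SubstEnv-respˡ σ q se) , e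
  Lin-subst⁺ σ (L ∷ Ls) (β , βs , ρ₁′ , ρ₂′ , refl , q , hl , hr) se with SubstEnv-⊕⁻ σ ρ₁′ ρ₂′ (SubstEnv-respˡ σ q se)
  ... | ρ₁ , ρ₂ , q′ , se₁ , se₂ with ⟦⟧Σ-find (⟦subst⟧⁺ σ L hl se₁) | Lin-subst⁺ σ Ls hr se₂
  ... | L′ , m₁ , hl′ | Ls′ , m₂ , hr′ = L′ ∷ Ls′ , ∈-substList⁺ σ L Ls m₁ m₂ , (β , βs , ρ₁ , ρ₂ , refl , q′ , hl′ , hr′)

  Tst-subst⁺ : ∀ {n m} (σ : Fin n → Sum m tm) (Ls : List (Exp n tm)) {ρ ρ′} → Tst Ls ρ′ → SubstEnv σ ρ′ ρ →
    ∃ λ Ls′ → Ls′ ∈ substList σ Ls × Tst Ls′ ρ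
  Tst-subst⁺ σ [] q se = [] , here refl , SubstEnv-∅⁻ σ (SubstEnv-respˡ σ q se)
  Tst-subst⁺ σ (L ∷ Ls) (ρ₁′ , ρ₂′ , q , hl , hr) se with SubstEnv-⊕⁻ σ ρ₁′ ρ₂′ (SubstEnv-respˡ σ q se)
  ... | ρ₁ , ρ₂ , q′ , se₁ , se₂ with ⟦⟧Σ-find (⟦subst⟧⁺ σ L hl se₁) | Tst-subst⁺ σ Ls hr se₂
  ... | L′ , m₁ , hl′ | Ls′ , m₂ , hr′ = L′ ∷ Ls′ , ∈-substList⁺ σ L Ls m₁ m₂ , (ρ₁ , ρ₂ , q′ , hl′ , hr′)

  ⟦substSum⟧⁺ : ∀ {n m} (σ : Fin n → Sum m tm) (N : Sum n tm) {ρ ρ′ v} → ⟦ N ⟧Σ ρ′ v → SubstEnv σ ρ′ ρ → ⟦ substSum σ N ⟧Σ ρ v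
  ⟦substSum⟧⁺ σ (e ∷ N) (inj₁ h) se = ⟦⟧Σ-++⁺ˡ (⟦subst⟧⁺ σ e h se)
  ⟦substSum⟧⁺ σ (e ∷ N) (inj₂ h) se = ⟦⟧Σ-++⁺ʳ (subst σ e) (⟦substSum⟧⁺ σ N h se)

  Prom-subst⁺ : ∀ {n m} (σ : Fin n → Sum m tm) (N : Sum n tm) γs {ρ ρ′} → Prom N ρ′ γs → SubstEnv σ ρ′ ρ → Prom (substSum σ N) ρ γs
  Prom-subst⁺ σ N [] q se = SubstEnv-∅⁻ σ (SubstEnv-respˡ σ q se)
  Prom-subst⁺ σ N (γ ∷ γs) (ρ₁′ , ρ₂′ , q , h , r) se with SubstEnv-⊕⁻ σ ρ₁′ ρ₂′ (SubstEnv-respˡ σ q se)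
  ... | ρ₁ , ρ₂ , q′ , se₁ , se₂ = ρ₁ , ρ₂ , q′ , ⟦substSum⟧⁺ σ N h se₁ , Prom-subst⁺ σ N γs r se₂

-- Linear substitution

≈ₘ-++-locate : ∀ {β s} r₁ r₂ → (β ∷ s) ≈ₘ (r₁ ++ r₂) →
  (∃ λ r₁′ → r₁ ≈ₘ (β ∷ r₁′) × s ≈ₘ (r₁′ ++ r₂)) ⊎ (∃ λ r₂′ → r₂ ≈ₘ (β ∷ r₂′) × s ≈ₘ (r₁ ++ r₂′))
≈ₘ-++-locate r₁ r₂ p = go p refl
  where
  go : ∀ {β s c} → (β ∷ s) ≈ₘ c → c ≡ r₁ ++ r₂ →
    (∃ λ r₁′ → r₁ ≈ₘ (β ∷ r₁′) × s ≈ₘ (r₁′ ++ r₂)) ⊎ (∃ λ r₂′ → r₂ ≈ₘ (β ∷ r₂′) × s ≈ₘ (r₁ ++ r₂′))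
  go (cons c₁ c₂ βγ q) eq with ++-∷-split r₁ r₂ c₁ _ c₂ (sym eq)
  ... | inj₁ (v , refl , refl) =
    inj₁ (c₁ ++ v , ≈ₘ-sym (cons c₁ v βγ (≈ₘ-refl _)) , ≈ₘ-resp-≡ʳ q (sym (++-assoc c₁ v r₂)))
  ... | inj₂ (v , refl , refl) =
    inj₂ (v ++ c₂ , ≈ₘ-sym (cons v c₂ βγ (≈ₘ-refl _)) , ≈ₘ-resp-≡ʳ q (++-assoc r₁ v c₂))

single⊕-locate : ∀ {n} (x : Fin n) {β} {σ ρ₁ ρ₂ : Env n} → (single x β ⊕ σ) ≋ (ρ₁ ⊕ ρ₂) →
  (∃ λ ρ₁′ → ρ₁ ≋ (single x β ⊕ ρ₁′) × σ ≋ (ρ₁′ ⊕ ρ₂)) ⊎ (∃ λ ρ₂′ → ρ₂ ≋ (single x β ⊕ ρ₂′) × σ ≋ (ρ₁ ⊕ ρ₂′))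
single⊕-locate zero {σ = s ∷ σ} {r₁ ∷ ρ₁} {r₂ ∷ ρ₂} (p ∷ ps) with ≈ₘ-++-locate r₁ r₂ p
... | inj₁ (r₁′ , a , b) = inj₁ (r₁′ ∷ ρ₁ , a ∷ ≋-sym (⊕-identityˡ ρ₁) , b ∷ ≋-trans (≋-sym (⊕-identityˡ σ)) ps)
... | inj₂ (r₂′ , a , b) = inj₂ (r₂′ ∷ ρ₂ , a ∷ ≋-sym (⊕-identityˡ ρ₂) , b ∷ ≋-trans (≋-sym (⊕-identityˡ σ)) ps)
single⊕-locate (suc x) {σ = s ∷ σ} {r₁ ∷ ρ₁} {r₂ ∷ ρ₂} (p ∷ ps) with single⊕-locate x ps
... | inj₁ (ρ₁′ , a , b) = inj₁ (r₁ ∷ ρ₁′ , ≈ₘ-refl r₁ ∷ a , p ∷ b)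
... | inj₂ (ρ₂′ , a , b) = inj₂ (r₂ ∷ ρ₂′ , ≈ₘ-refl r₂ ∷ a , p ∷ b)

single⊕≉∅ : ∀ {n} (x : Fin n) {β} {σ : Env n} → (single x β ⊕ σ) ≋ ∅ → ⊥
single⊕≉∅ zero {σ = s ∷ σ} (p ∷ ps) with ≈ₘ-[]ʳ p
... | ()
single⊕≉∅ (suc x) {σ = s ∷ σ} (p ∷ ps) = single⊕≉∅ x ps

∷-≈ₘ-[-] : ∀ {β s α} → (β ∷ s) ≈ₘ (α ∷ []) → β ≈ α × s ≡ []
∷-≈ₘ-[-] p = go p refl
  where
  go : ∀ {β s c α} → (β ∷ s) ≈ₘ c → c ≡ α ∷ [] → β ≈ α × s ≡ []
  go (cons [] [] βα q) refl = βα , ≈ₘ-[]ʳ q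
  go (cons [] (_ ∷ _) βα q) ()
  go (cons (_ ∷ []) c₂ βα q) ()
  go (cons (_ ∷ _ ∷ _) c₂ βα q) ()

single⊕≋single : ∀ {n} (x y : Fin n) {β α} {σ : Env n} → (single x β ⊕ σ) ≋ single y α → x ≡ y × β ≈ α × σ ≋ ∅
single⊕≋single zero zero {σ = s ∷ σ} (p ∷ ps) with ∷-≈ₘ-[-] p
... | βα , refl = refl , βα , [] ∷ ≋-trans (≋-sym (⊕-identityˡ σ)) ps
single⊕≋single zero (suc y) {σ = s ∷ σ} (p ∷ ps) with ≈ₘ-[]ʳ p
... | ()
single⊕≋single (suc x) zero {σ = s ∷ σ} (p ∷ ps) = ⊥-elim (single⊕≉∅ x ps)
single⊕≋single (suc x) (suc y) {σ = s ∷ σ} (p ∷ ps) with ≈ₘ-[]ʳ p | single⊕≋single x y ps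
... | refl | refl , βα , q = refl , βα , [] ∷ q

Prom-single⊕-locate : ∀ {n} (N : Sum n tm) (x : Fin n) {β} γs {ρ′ : Env n} → Prom N (single x β ⊕ ρ′) γs →
  ∃₂ λ γ γs₁ → ∃ λ γs₂ → ∃₂ λ ρa ρb →
    γs ≡ γs₁ ++ γ ∷ γs₂ × ρ′ ≋ (ρa ⊕ ρb) × ⟦ N ⟧Σ (single x β ⊕ ρa) γ × Prom N ρb (γs₁ ++ γs₂)
Prom-single⊕-locate N x [] q = ⊥-elim (single⊕≉∅ x q)
Prom-single⊕-locate N x (γ ∷ γs) (ρ₁ , _ , q , h , r) with single⊕-locate x q
... | inj₁ (ρ₁′ , a , b) = γ , [] , γs , ρ₁′ , _ , refl , b , ⟦⟧Σ-resp N a (≈-refl γ) h , r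
... | inj₂ (ρ₂′ , a , b) with Prom-single⊕-locate N x γs (Prom-resp N a r)
... | γ′ , γs₁ , γs₂ , ρa , ρb , refl , c , h′ , r′ =
  γ′ , γ ∷ γs₁ , γs₂ , ρa , ρ₁ ⊕ ρb , refl , refineʳ-swap b c , h′ , (ρ₁ , ρb , ≋-refl _ , h , r′)

-- LinSub x N P ρ: ρ arises from an environment satisfying P by trading
-- one occurrence of x, of value β, for an environment in which N yields β.
LinSub : ∀ {n} (x : Fin n) (N : Exp n tm) (P : Env n → Set) (ρ : Env n) → Set
LinSub x N P ρ = ∃ λ β → ∃₂ λ σ τ → ρ ≋ (σ ⊕ τ) × P (single x β ⊕ σ) × ⟦ N ⟧ τ β

∈-lsubList⁻ : ∀ {n} (x : Fin n) N L Ls {Ks} → Ks ∈ lsubList x N (L ∷ Ls) →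
  (∃ λ L′ → Ks ≡ L′ ∷ Ls × L′ ∈ lsub x N L) ⊎ (∃ λ Ls′ → Ks ≡ L ∷ Ls′ × Ls′ ∈ lsubList x N Ls)
∈-lsubList⁻ x N L Ls m with ∈-++⁻ (map (_∷ Ls) (lsub x N L)) m
... | inj₁ m₁ = let L′ , m₂ , eq = ∈-map⁻ (_∷ Ls) m₁ in inj₁ (L′ , eq , m₂)
... | inj₂ m₁ = let Ls′ , m₂ , eq = ∈-map⁻ (L ∷_) m₁ in inj₂ (Ls′ , eq , m₂)

mutual
  ⟦lsub⟧⁻ : ∀ {n s} (x : Fin n) (N : Exp n tm) (e : Exp n s) {ρ v} → ⟦ lsub x N e ⟧Σ ρ v → LinSub x N (λ ρ′ → ⟦ e ⟧ ρ′ v) ρ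
  ⟦lsub⟧⁻ x N (var y) h with x ≟ y
  ⟦lsub⟧⁻ x N (var y) {ρ} {α} (inj₁ h) | yes refl = α , ∅ , ρ , ≋-sym (⊕-identityˡ ρ) , ⊕-identityʳ _ , h
  ⟦lsub⟧⁻ x N (var y) (inj₂ ()) | yes refl
  ⟦lsub⟧⁻ x N (var y) () | no _
  ⟦lsub⟧⁻ x N (lam M) h with ⟦⟧Σ-map⁻ lam (lsub (suc x) (weaken N) M) h
  ... | _ , me , (b , β′ , q , m) with ⟦lsub⟧⁻ (suc x) (weaken N) M (⟦⟧Σ-lose me m)
  ... | β , d ∷ σ′ , _ ∷ τ′ , p ∷ ps , m′ , hn with ⟦weaken⟧⁻ N hn
  ... | refl , hn′ = β , σ′ , τ′ , ps , (d , β′ , ≈-trans q (::-congˡ β′ (≈ₘ-trans p (≈ₘ-++-identityʳ d))) , m′) , hn′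
  ⟦lsub⟧⁻ x N (app M P) h with ⟦⟧Σ-++⁻ (map (λ M′ → app M′ P) (lsub x N M)) h
  ... | inj₁ h₁ with ⟦⟧Σ-map⁻ (λ M′ → app M′ P) (lsub x N M) h₁
  ... | _ , mM , (b , _ , ρ₂ , q , hm , hp) with ⟦lsub⟧⁻ x N M (⟦⟧Σ-lose mM hm)
  ... | β , σ′ , τ , q′ , hm′ , hn =
    β , σ′ ⊕ ρ₂ , τ , refineˡ-swap q q′ , (b , single x β ⊕ σ′ , ρ₂ , ≋-sym (⊕-assoc _ σ′ ρ₂) , hm′ , hp) , hn
  ⟦lsub⟧⁻ x N (app M P) h | inj₂ h₂ with ⟦⟧Σ-map⁻ (app M) (lsub x N P) h₂
  ... | _ , mP , (b , ρ₁ , _ , q , hm , hp) with ⟦lsub⟧⁻ x N P (⟦⟧Σ-lose mP hp)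
  ... | β , σ′ , τ , q′ , hp′ , hn =
    β , ρ₁ ⊕ σ′ , τ , refineʳ-assoc q q′ , (b , ρ₁ , single x β ⊕ σ′ , x∙yz≈y∙xz _ ρ₁ σ′ , hm , hp′) , hn
  ⟦lsub⟧⁻ x N (tbar V) h with ⟦⟧Σ-map⁻ tbar (lsub x N V) h
  ... | _ , mV , (q , hv) with ⟦lsub⟧⁻ x N V (⟦⟧Σ-lose mV hv)
  ... | β , σ , τ , q′ , hv′ , hn = β , σ , τ , q′ , (q , hv′) , hn
  ⟦lsub⟧⁻ x N (bag Ls 𝐍) h with ⟦⟧Σ-++⁻ (map (λ Ls′ → bag Ls′ 𝐍) (lsubList x N Ls)) h
  ... | inj₁ h₁ with ⟦⟧Σ-map⁻ (λ Ls′ → bag Ls′ 𝐍) (lsubList x N Ls) h₁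
  ... | _ , mL , (_ , ρ₂ , βs , γs , q , l , p , w) with Lin-lsub⁻ x N Ls mL l
  ... | β , σ′ , τ , q′ , l′ , hn =
    β , σ′ ⊕ ρ₂ , τ , refineˡ-swap q q′ , (single x β ⊕ σ′ , ρ₂ , βs , γs , ≋-sym (⊕-assoc _ σ′ ρ₂) , l′ , p , w) , hn
  ⟦lsub⟧⁻ x N (bag Ls 𝐍) h | inj₂ h₂ = ⟦lsub-prom⟧⁻ x N Ls 𝐍 h₂
  ⟦lsub⟧⁻ x N (test Ls) h with ⟦⟧Σ-map⁻ test (lsubList x N Ls) h
  ... | _ , mL , t = Tst-lsub⁻ x N Ls mL t

  -- The summand M′ of 𝐍⟨N/x⟩ appended to the linear part is read back
  -- as one more element γ of the promotion of 𝐍.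
  ⟦lsub-prom⟧⁻ : ∀ {n} (x : Fin n) (N : Exp n tm) Ls 𝐍 {ρ v} → ⟦ map (λ M′ → bag (Ls ∷ʳ M′) 𝐍) (lsubSum x N 𝐍) ⟧Σ ρ v →
    LinSub x N (λ ρ′ → ⟦ bag Ls 𝐍 ⟧ ρ′ v) ρ
  ⟦lsub-prom⟧⁻ x N Ls 𝐍 h with ⟦⟧Σ-map⁻ (λ M′ → bag (Ls ∷ʳ M′) 𝐍) (lsubSum x N 𝐍) h
  ... | _ , mM , (_ , ρ₂ , _ , γs , q , l , p , w) with Lin-++⁻ Ls l
  ... | βs₁ , _ , ρa , _ , refl , qa , la , (γ , _ , ρc , _ , refl , qc , hc , (qd , refl)) with ⟦lsubSum⟧⁻ x N 𝐍 (⟦⟧Σ-lose mM hc)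
  ... | β , σ′ , τ , q′ , hc′ , hn =
    β , ρa ⊕ (σ′ ⊕ ρ₂) , τ , split ,
    (ρa , (single x β ⊕ σ′) ⊕ ρ₂ , βs₁ , γ ∷ γs ,
       ≋-trans (x∙yz≈y∙xz _ ρa (σ′ ⊕ ρ₂)) (⊕-cong (≋-refl ρa) (≋-sym (⊕-assoc _ σ′ ρ₂))) ,
       la , (single x β ⊕ σ′ , ρ₂ , ≋-refl _ , hc′ , p) , ≈ₘ-resp-≡ʳ w (++-assoc βs₁ (γ ∷ []) γs)) ,
    hn
    where
    split : _ ≋ ((ρa ⊕ (σ′ ⊕ ρ₂)) ⊕ τ)
    split = ≋-trans q (≋-trans (⊕-cong (refineʳ qa (≋-trans qc (≋-trans (⊕-cong q′ qd) (⊕-identityʳ _)))) (≋-refl ρ₂))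
      (solve 4 (λ a s t r → (a ⊞ (s ⊞ t)) ⊞ r ⊜ (a ⊞ (s ⊞ r)) ⊞ t) (≋-refl _) ρa σ′ τ ρ₂))

  Lin-lsub⁻ : ∀ {n} (x : Fin n) (N : Exp n tm) (Ls : List (Exp n tm)) {Ls′ ρ βs} → Ls′ ∈ lsubList x N Ls → Lin Ls′ ρ βs →
    LinSub x N (λ ρ′ → Lin Ls ρ′ βs) ρ
  Lin-lsub⁻ x N (L ∷ Ls) mL l with ∈-lsubList⁻ x N L Ls mL | l
  ... | inj₁ (_ , refl , m) | β′ , βs′ , _ , ρ₂ , refl , q , hl , hr with ⟦lsub⟧⁻ x N L (⟦⟧Σ-lose m hl)
  ... | β , σ′ , τ , q′ , hl′ , hn =
    β , σ′ ⊕ ρ₂ , τ , refineˡ-swap q q′ , (β′ , βs′ , single x β ⊕ σ′ , ρ₂ , refl , ≋-sym (⊕-assoc _ σ′ ρ₂) , hl′ , hr) , hn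
  Lin-lsub⁻ x N (L ∷ Ls) mL l | inj₂ (_ , refl , m) | β′ , βs′ , ρ₁ , _ , refl , q , hl , hr with Lin-lsub⁻ x N Ls m hr
  ... | β , σ′ , τ , q′ , hr′ , hn =
    β , ρ₁ ⊕ σ′ , τ , refineʳ-assoc q q′ , (β′ , βs′ , ρ₁ , single x β ⊕ σ′ , refl , x∙yz≈y∙xz _ ρ₁ σ′ , hl , hr′) , hn

  Tst-lsub⁻ : ∀ {n} (x : Fin n) (N : Exp n tm) (Ls : List (Exp n tm)) {Ls′ ρ} → Ls′ ∈ lsubList x N Ls → Tst Ls′ ρ →
    LinSub x N (λ ρ′ → Tst Ls ρ′) ρ
  Tst-lsub⁻ x N (L ∷ Ls) mL t with ∈-lsubList⁻ x N L Ls mL | t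
  ... | inj₁ (_ , refl , m) | _ , ρ₂ , q , hl , hr with ⟦lsub⟧⁻ x N L (⟦⟧Σ-lose m hl)
  ... | β , σ′ , τ , q′ , hl′ , hn =
    β , σ′ ⊕ ρ₂ , τ , refineˡ-swap q q′ , (single x β ⊕ σ′ , ρ₂ , ≋-sym (⊕-assoc _ σ′ ρ₂) , hl′ , hr) , hn
  Tst-lsub⁻ x N (L ∷ Ls) mL t | inj₂ (_ , refl , m) | ρ₁ , _ , q , hl , hr with Tst-lsub⁻ x N Ls m hr
  ... | β , σ′ , τ , q′ , hr′ , hn =
    β , ρ₁ ⊕ σ′ , τ , refineʳ-assoc q q′ , (ρ₁ , single x β ⊕ σ′ , x∙yz≈y∙xz _ ρ₁ σ′ , hl , hr′) , hn

  ⟦lsubSum⟧⁻ : ∀ {n} (x : Fin n) (N : Exp n tm) (𝐍 : Sum n tm) {ρ v} → ⟦ lsubSum x N 𝐍 ⟧Σ ρ v → LinSub x N (λ ρ′ → ⟦ 𝐍 ⟧Σ ρ′ v) ρ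
  ⟦lsubSum⟧⁻ x N (e ∷ 𝐍) h with ⟦⟧Σ-++⁻ (lsub x N e) h
  ... | inj₁ h₁ with ⟦lsub⟧⁻ x N e h₁
  ... | β , σ , τ , q , h′ , hn = β , σ , τ , q , inj₁ h′ , hn
  ⟦lsubSum⟧⁻ x N (e ∷ 𝐍) h | inj₂ h₂ with ⟦lsubSum⟧⁻ x N 𝐍 h₂
  ... | β , σ , τ , q , h′ , hn = β , σ , τ , q , inj₂ h′ , hn

mutual
  ⟦lsub⟧⁺ : ∀ {n s} (x : Fin n) (N : Exp n tm) (e : Exp n s) {ρ β σ τ v} →
    ρ ≋ (σ ⊕ τ) → ⟦ e ⟧ (single x β ⊕ σ) v → ⟦ N ⟧ τ β → ⟦ lsub x N e ⟧Σ ρ v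
  ⟦lsub⟧⁺ x N (var y) {τ = τ} p h hn with single⊕≋single x y h
  ... | refl , βα , σ∅ with x ≟ x
  ... | yes _ = inj₁ (⟦⟧-resp N (≋-sym (≋-trans (refineˡ p σ∅) (⊕-identityˡ τ))) βα hn)
  ... | no x≢x = ⊥-elim (x≢x refl)
  ⟦lsub⟧⁺ x N (lam M) {ρ} {β} {σ} {τ} p (b , β′ , q , m) hn
    with ⟦⟧Σ-find (⟦lsub⟧⁺ (suc x) (weaken N) M {b ∷ ρ} {β} {b ∷ σ} {[] ∷ τ} (≈ₘ-sym (≈ₘ-++-identityʳ b) ∷ p) m (⟦weaken⟧⁺ N hn))
  ... | _ , me , h = ⟦⟧Σ-map⁺ lam me (b , β′ , q , h)
  ⟦lsub⟧⁺ x N (app M P) {τ = τ} p (b , ρ₁ , ρ₂ , q , hm , hp) hn with single⊕-locate x q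
  ... | inj₁ (ρ₁′ , a , c) with ⟦⟧Σ-find (⟦lsub⟧⁺ x N M (≋-refl (ρ₁′ ⊕ τ)) (⟦⟧-resp M a (≈-refl _) hm) hn)
  ... | M′ , mM , hm′ =
    ⟦⟧Σ-++⁺ˡ (⟦⟧Σ-map⁺ (λ M′ → app M′ P) mM (b , ρ₁′ ⊕ τ , ρ₂ , refineˡ-swap p c , hm′ , hp))
  ⟦lsub⟧⁺ x N (app M P) {τ = τ} p (b , ρ₁ , ρ₂ , q , hm , hp) hn | inj₂ (ρ₂′ , a , c)
    with ⟦⟧Σ-find (⟦lsub⟧⁺ x N P (≋-refl (ρ₂′ ⊕ τ)) (⟦⟧-resp P a (≈ₘ-refl _) hp) hn)
  ... | P′ , mP , hp′ =
    ⟦⟧Σ-++⁺ʳ (map (λ M′ → app M′ P) (lsub x N M)) (⟦⟧Σ-map⁺ (app M) mP (b , ρ₁ , ρ₂′ ⊕ τ , refineˡ-assoc p c , hm , hp′))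
  ⟦lsub⟧⁺ x N (tbar V) p (q , hv) hn with ⟦⟧Σ-find (⟦lsub⟧⁺ x N V p hv hn)
  ... | _ , mV , hv′ = ⟦⟧Σ-map⁺ tbar mV (q , hv′)
  ⟦lsub⟧⁺ x N (bag Ls 𝐍) {τ = τ} p (ρ₁ , ρ₂ , βs , γs , q , l , pr , w) hn with single⊕-locate x q
  ... | inj₁ (ρ₁′ , a , c) with Lin-lsub⁺ x N Ls (Lin-resp Ls a l) (≋-refl (ρ₁′ ⊕ τ)) hn
  ... | _ , mL , l′ =
    ⟦⟧Σ-++⁺ˡ (⟦⟧Σ-map⁺ (λ Ls′ → bag Ls′ 𝐍) mL (ρ₁′ ⊕ τ , ρ₂ , βs , γs , refineˡ-swap p c , l′ , pr , w))
  ⟦lsub⟧⁺ x N (bag Ls 𝐍) p (ρ₁ , ρ₂ , βs , γs , q , l , pr , w) hn | inj₂ (ρ₂′ , a , c) =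
    ⟦⟧Σ-++⁺ʳ (map (λ Ls′ → bag Ls′ 𝐍) (lsubList x N Ls)) (⟦lsub-prom⟧⁺ x N Ls 𝐍 p c l (Prom-resp 𝐍 a pr) w hn)
  ⟦lsub⟧⁺ x N (test Ls) p t hn with Tst-lsub⁺ x N Ls p t hn
  ... | _ , mL , t′ = ⟦⟧Σ-map⁺ test mL t′

  -- Conversely, the substituted occurrence of x may sit in one element γ
  -- of the promotion, which then becomes the new linear element.
  ⟦lsub-prom⟧⁺ : ∀ {n} (x : Fin n) (N : Exp n tm) Ls 𝐍 {ρ β σ τ ρ₁ ρ₂′ βs γs v} →
    ρ ≋ (σ ⊕ τ) → σ ≋ (ρ₁ ⊕ ρ₂′) → Lin Ls ρ₁ βs → Prom 𝐍 (single x β ⊕ ρ₂′) γs → v ≈ₘ (βs ++ γs) → ⟦ N ⟧ τ β →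
    ⟦ map (λ M′ → bag (Ls ∷ʳ M′) 𝐍) (lsubSum x N 𝐍) ⟧Σ ρ v
  ⟦lsub-prom⟧⁺ x N Ls 𝐍 {τ = τ} {ρ₁} {βs = βs} p c l pr w hn with Prom-single⊕-locate 𝐍 x _ pr
  ... | γ , γs₁ , γs₂ , ρa , ρb , refl , c′ , hγ , pr′ with ⟦⟧Σ-find (⟦lsubSum⟧⁺ x N 𝐍 (≋-refl (ρa ⊕ τ)) hγ hn)
  ... | _ , mM , hM′ =
    ⟦⟧Σ-map⁺ (λ M′ → bag (Ls ∷ʳ M′) 𝐍) mM
      (ρ₁ ⊕ (ρa ⊕ τ) , ρb , βs ++ γ ∷ [] , γs₁ ++ γs₂ , split ,
       Lin-++⁺ Ls (≋-refl _) l (γ , [] , ρa ⊕ τ , ∅ , refl , ≋-sym (⊕-identityʳ _) , hM′ , (≋-refl ∅ , refl)) , pr′ ,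
       ≈ₘ-trans w (≈ₘ-resp-≡ʳ (≈ₘ-++ (≈ₘ-refl βs) (≈ₘ-sym (cons γs₁ γs₂ (≈-refl γ) (≈ₘ-refl _))))
                              (sym (++-assoc βs (γ ∷ []) (γs₁ ++ γs₂)))))
    where
    split : _ ≋ ((ρ₁ ⊕ (ρa ⊕ τ)) ⊕ ρb)
    split = ≋-trans p (≋-trans (⊕-cong (refineʳ c c′) (≋-refl τ))
      (solve 4 (λ r a b t → (r ⊞ (a ⊞ b)) ⊞ t ⊜ (r ⊞ (a ⊞ t)) ⊞ b) (≋-refl _) ρ₁ ρa ρb τ))

  Lin-lsub⁺ : ∀ {n} (x : Fin n) (N : Exp n tm) (Ls : List (Exp n tm)) {ρ β σ τ βs} →
    Lin Ls (single x β ⊕ σ) βs → ρ ≋ (σ ⊕ τ) → ⟦ N ⟧ τ β → ∃ λ Ls′ → Ls′ ∈ lsubList x N Ls × Lin Ls′ ρ βs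
  Lin-lsub⁺ x N [] (q , e) p hn = ⊥-elim (single⊕≉∅ x q)
  Lin-lsub⁺ x N (L ∷ Ls) {τ = τ} (β′ , βs′ , ρ₁ , ρ₂ , refl , q , hl , hr) p hn with single⊕-locate x q
  ... | inj₁ (ρ₁′ , a , c) with ⟦⟧Σ-find (⟦lsub⟧⁺ x N L (≋-refl (ρ₁′ ⊕ τ)) (⟦⟧-resp L a (≈-refl _) hl) hn)
  ... | L′ , m , hl′ = L′ ∷ Ls , ∈-++⁺ˡ (∈-map⁺ (_∷ Ls) m) , (β′ , βs′ , ρ₁′ ⊕ τ , ρ₂ , refl , refineˡ-swap p c , hl′ , hr)
  Lin-lsub⁺ x N (L ∷ Ls) {τ = τ} (β′ , βs′ , ρ₁ , ρ₂ , refl , q , hl , hr) p hn | inj₂ (ρ₂′ , a , c)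
    with Lin-lsub⁺ x N Ls (Lin-resp Ls a hr) (≋-refl (ρ₂′ ⊕ τ)) hn
  ... | Ls′ , m , hr′ =
    L ∷ Ls′ , ∈-++⁺ʳ (map (_∷ Ls) (lsub x N L)) (∈-map⁺ (L ∷_) m) , (β′ , βs′ , ρ₁ , ρ₂′ ⊕ τ , refl , refineˡ-assoc p c , hl , hr′)

  Tst-lsub⁺ : ∀ {n} (x : Fin n) (N : Exp n tm) (Ls : List (Exp n tm)) {ρ β σ τ} →
    ρ ≋ (σ ⊕ τ) → Tst Ls (single x β ⊕ σ) → ⟦ N ⟧ τ β → ∃ λ Ls′ → Ls′ ∈ lsubList x N Ls × Tst Ls′ ρ
  Tst-lsub⁺ x N [] p q hn = ⊥-elim (single⊕≉∅ x q)
  Tst-lsub⁺ x N (L ∷ Ls) {τ = τ} p (ρ₁ , ρ₂ , q , hl , hr) hn with single⊕-locate x q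
  ... | inj₁ (ρ₁′ , a , c) with ⟦⟧Σ-find (⟦lsub⟧⁺ x N L (≋-refl (ρ₁′ ⊕ τ)) (⟦⟧-resp L a (≈-refl _) hl) hn)
  ... | L′ , m , hl′ = L′ ∷ Ls , ∈-++⁺ˡ (∈-map⁺ (_∷ Ls) m) , (ρ₁′ ⊕ τ , ρ₂ , refineˡ-swap p c , hl′ , hr)
  Tst-lsub⁺ x N (L ∷ Ls) {τ = τ} p (ρ₁ , ρ₂ , q , hl , hr) hn | inj₂ (ρ₂′ , a , c)
    with Tst-lsub⁺ x N Ls (≋-refl (ρ₂′ ⊕ τ)) (Tst-resp Ls a hr) hn
  ... | Ls′ , m , hr′ = L ∷ Ls′ , ∈-++⁺ʳ (map (_∷ Ls) (lsub x N L)) (∈-map⁺ (L ∷_) m) , (ρ₁ , ρ₂′ ⊕ τ , refineˡ-assoc p c , hl , hr′)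

  ⟦lsubSum⟧⁺ : ∀ {n} (x : Fin n) (N : Exp n tm) (𝐍 : Sum n tm) {ρ β σ τ v} →
    ρ ≋ (σ ⊕ τ) → ⟦ 𝐍 ⟧Σ (single x β ⊕ σ) v → ⟦ N ⟧ τ β → ⟦ lsubSum x N 𝐍 ⟧Σ ρ v
  ⟦lsubSum⟧⁺ x N (e ∷ 𝐍) p (inj₁ h) hn = ⟦⟧Σ-++⁺ˡ (⟦lsub⟧⁺ x N e p h hn)
  ⟦lsubSum⟧⁺ x N (e ∷ 𝐍) p (inj₂ h) hn = ⟦⟧Σ-++⁺ʳ (lsub x N e) (⟦lsubSum⟧⁺ x N 𝐍 p h hn)

⟦lsubMany⟧⁻ : ∀ {n} (A : Sum (suc n) tm) (Ls : List (Exp n tm)) {c ρ α} → ⟦ lsubMany A Ls ⟧Σ (c ∷ ρ) α →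
  ∃ λ βs → ∃₂ λ ρ₁ ρ₂ → ρ ≋ (ρ₁ ⊕ ρ₂) × Lin Ls ρ₂ βs × ⟦ A ⟧Σ ((βs ++ c) ∷ ρ₁) α
⟦lsubMany⟧⁻ A [] {ρ = ρ} h = [] , ρ , ∅ , ≋-sym (⊕-identityʳ ρ) , (≋-refl ∅ , refl) , h
⟦lsubMany⟧⁻ A (L ∷ Ls) h with ⟦lsubMany⟧⁻ (concatMap (lsub zero (weaken L)) A) Ls h
... | βs , ρ₁ , ρ₂ , q , l , h′ with ⟦⟧Σ-concatMap⁻ (lsub zero (weaken L)) A h′
... | e , me , he with ⟦lsub⟧⁻ zero (weaken L) e he
... | β , d ∷ σ′ , _ ∷ τ′ , p ∷ ps , he′ , hL with ⟦weaken⟧⁻ L hL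
... | refl , hL′ =
  β ∷ βs , σ′ , τ′ ⊕ ρ₂ , refineˡ-assoc q ps , (β , βs , τ′ , ρ₂ , refl , ≋-refl _ , hL′ , l) ,
  ⟦⟧Σ-lose me (⟦⟧-resp e (cons [] _ (≈-refl β) (≈ₘ-sym (≈ₘ-trans p (≈ₘ-++-identityʳ d))) ∷ ⊕-identityˡ σ′) (≈-refl _) he′)

⟦lsubMany⟧⁺ : ∀ {n} (A : Sum (suc n) tm) (Ls : List (Exp n tm)) {c ρ ρ₁ ρ₂ βs α} → ρ ≋ (ρ₁ ⊕ ρ₂) → Lin Ls ρ₂ βs →
  ⟦ A ⟧Σ ((βs ++ c) ∷ ρ₁) α → ⟦ lsubMany A Ls ⟧Σ (c ∷ ρ) α
⟦lsubMany⟧⁺ A [] {c} q (e , refl) h =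
  ⟦⟧Σ-resp A (≈ₘ-refl c ∷ ≋-sym (≋-trans (refineʳ q e) (⊕-identityʳ _))) (≈-refl _) h
⟦lsubMany⟧⁺ A (L ∷ Ls) {c} {ρ₁ = ρ₁} q (β , βs , ρa , _ , refl , q₂ , hL , hls) h with ⟦⟧Σ-find h
... | e , me , he =
  ⟦lsubMany⟧⁺ (concatMap (lsub zero (weaken L)) A) Ls {ρ₁ = ρ₁ ⊕ ρa} (refineʳ-assoc q q₂) hls
    (⟦⟧Σ-concatMap⁺ (lsub zero (weaken L)) me
      (⟦lsub⟧⁺ zero (weaken L) e {σ = (βs ++ c) ∷ ρ₁} {τ = [] ∷ ρa} (≈ₘ-sym (≈ₘ-++-identityʳ _) ∷ ≋-refl _)
        (⟦⟧-resp e (≈ₘ-refl _ ∷ ≋-sym (⊕-identityˡ ρ₁)) (≈-refl _) he) (⟦weaken⟧⁺ L hL)))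

-- Soundness of reduction

::-injective : ∀ {b b′} (α β : D) → (b :: α) ≈ (b′ :: β) → b ≈ₘ b′ × α ≈ β
::-injective (seq s) (seq t) (seq≈ (p ∷ q)) = p , seq≈ q

⋆≈:: : ∀ {b} (β : D) → ⋆ ≈ (b :: β) → b ≡ [] × β ≈ ⋆
⋆≈:: (seq t) (seq≈ (padˡ p)) = refl , seq≈ (≈ₛ-sym p)

::≈⋆ : ∀ {b} (α : D) → (b :: α) ≈ ⋆ → b ≡ [] × α ≈ ⋆
::≈⋆ (seq s) (seq≈ (padʳ p)) = refl , seq≈ p

[]::≈⋆ : (α : D) → α ≈ ⋆ → ([] :: α) ≈ ⋆
[]::≈⋆ (seq s) (seq≈ p) = seq≈ (padʳ p)

infix 4 _≅_
_≅_ : ∀ {n s} → Exp n s → Sum n s → Set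
e ≅ 𝔼 = ∀ {ρ v} → ⟦ e ⟧ ρ v ⇔ ⟦ 𝔼 ⟧Σ ρ v

SubstEnv-σ₀⁺ : ∀ {n} (N : Sum n tm) c (ρ′ : Env n) {ρ r} → ρ ≋ (r ⊕ ρ′) → Prom N r c → SubstEnv (σ₀ N) (c ∷ ρ′) ρ
SubstEnv-σ₀⁺ N c ρ′ q p = _ , ρ′ , q , p , SubstEnv-ren⁺ (λ i → i) ρ′ (≋-sym (push-id ρ′))

SubstEnv-σ₀⁻ : ∀ {n} (N : Sum n tm) c (ρ′ : Env n) {ρ} → SubstEnv (σ₀ N) (c ∷ ρ′) ρ → ∃ λ r → ρ ≋ (r ⊕ ρ′) × Prom N r c
SubstEnv-σ₀⁻ N c ρ′ (r , _ , q , p , se) = r , refineʳ q (≋-trans (SubstEnv-ren⁻ (λ i → i) ρ′ se) (push-id ρ′)) , p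

beta⁻ : ∀ {n} (M : Exp (suc n) tm) (Ls N : List (Exp n tm)) {ρ α} → ⟦ app (lam M) (bag Ls N) ⟧ ρ α →
  ⟦ concatMap (subst (σ₀ N)) (lsubMany (M ∷ []) Ls) ⟧Σ ρ α
beta⁻ M Ls N {ρ} {α} (b , ρ₁ , _ , q , (_ , β , b::α≈ , m) , (ρa , ρb , βs , γs , q₂ , l , p , w)) with ::-injective α β b::α≈
... | b≈ , α≈β with ⟦⟧Σ-find (⟦lsubMany⟧⁺ (M ∷ []) Ls {c = γs} {ρ = ρ₁ ⊕ ρa} (≋-refl _) l
                        (inj₁ (⟦⟧-resp M (≈ₘ-trans (≈ₘ-sym b≈) w ∷ ≋-refl ρ₁) (≈-sym α≈β) m)))
... | e , me , he = ⟦⟧Σ-concatMap⁺ (subst (σ₀ N)) me (⟦subst⟧⁺ (σ₀ N) e he (SubstEnv-σ₀⁺ N γs (ρ₁ ⊕ ρa) split p))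
  where
  split : ρ ≋ (ρb ⊕ (ρ₁ ⊕ ρa))
  split = ≋-trans (refineʳ q q₂) (solve 3 (λ r a b → r ⊞ (a ⊞ b) ⊜ b ⊞ (r ⊞ a)) (≋-refl _) ρ₁ ρa ρb)

beta⁺ : ∀ {n} (M : Exp (suc n) tm) (Ls N : List (Exp n tm)) {ρ α} →
  ⟦ concatMap (subst (σ₀ N)) (lsubMany (M ∷ []) Ls) ⟧Σ ρ α → ⟦ app (lam M) (bag Ls N) ⟧ ρ α
beta⁺ M Ls N {ρ} {α} h with ⟦⟧Σ-concatMap⁻ (subst (σ₀ N)) (lsubMany (M ∷ []) Ls) h
... | e , me , he with ⟦subst⟧⁻ (σ₀ N) e he
... | c ∷ ρ′ , he′ , se with SubstEnv-σ₀⁻ N c ρ′ se | ⟦lsubMany⟧⁻ (M ∷ []) Ls (⟦⟧Σ-lose me he′)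
... | r , q , p | βs , ρ₁ , ρ₂ , q′ , l , inj₁ m =
  βs ++ c , ρ₁ , ρ₂ ⊕ r , split , (βs ++ c , α , ≈-refl _ , m) , (ρ₂ , r , βs , c , ≋-refl _ , l , p , ≈ₘ-refl _)
  where
  split : ρ ≋ (ρ₁ ⊕ (ρ₂ ⊕ r))
  split = ≋-trans (refineʳ q q′) (solve 3 (λ r a b → r ⊞ (a ⊞ b) ⊜ a ⊞ (b ⊞ r)) (≋-refl _) r ρ₁ ρ₂)

beta-sound : ∀ {n} (M : Exp (suc n) tm) (Ls N : List (Exp n tm)) →
  app (lam M) (bag Ls N) ≅ concatMap (subst (σ₀ N)) (lsubMany (M ∷ []) Ls)
beta-sound M Ls N = mk⇔ (beta⁻ M Ls N) (beta⁺ M Ls N)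

tbar-nil-sound : ∀ {n} (V : Exp n ts) (N : List (Exp n tm)) → app (tbar V) (bag [] N) ≅ (tbar V ∷ [])
tbar-nil-sound V N = mk⇔ to from
  where
  to : ∀ {ρ v} → ⟦ app (tbar V) (bag [] N) ⟧ ρ v → ⟦ tbar V ∷ [] ⟧Σ ρ v
  to {v = α} (_ , ρ₁ , _ , q , (e , t) , (_ , _ , [] , _ , q₂ , (e₁ , refl) , p , w)) with ::≈⋆ α e
  ... | refl , α≈⋆ with ≈ₘ-[]ˡ w
  ... | refl = inj₁ (α≈⋆ , ⟦⟧-resp V (≋-sym (≋-trans (refineʳ q bag≋∅) (⊕-identityʳ ρ₁))) tt t)
    where bag≋∅ = ≋-trans q₂ (≋-trans (⊕-cong e₁ p) (⊕-identityˡ ∅))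
  from : ∀ {ρ v} → ⟦ tbar V ∷ [] ⟧Σ ρ v → ⟦ app (tbar V) (bag [] N) ⟧ ρ v
  from {ρ} {α} (inj₁ (α≈⋆ , t)) =
    [] , ρ , ∅ , ≋-sym (⊕-identityʳ ρ) , ([]::≈⋆ α α≈⋆ , t) ,
    (∅ , ∅ , [] , [] , ≋-sym (⊕-identityˡ ∅) , (≋-refl ∅ , refl) , ≋-refl ∅ , [])

-- ⟦τ̄(V)⟧ only contains ⋆ = [] :: ⋆, so the argument bag must denote [].
tbar-cons-sound : ∀ {n} (V : Exp n ts) (L : Exp n tm) (Ls N : List (Exp n tm)) → app (tbar V) (bag (L ∷ Ls) N) ≅ []
tbar-cons-sound V L Ls N = mk⇔ to λ ()
  where
  to : ∀ {ρ v} → ⟦ app (tbar V) (bag (L ∷ Ls) N) ⟧ ρ v → ⊥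
  to {v = α} (_ , _ , _ , _ , (e , _) , (_ , _ , _ , _ , _ , (_ , _ , _ , _ , refl , _) , _ , w)) with ::≈⋆ α e
  ... | refl , _ with ≈ₘ-[]ˡ w
  ... | ()

Prom-0⁻ : ∀ {n} {r : Env n} c → Prom [] r c → c ≡ [] × r ≋ ∅
Prom-0⁻ [] h = refl , h
Prom-0⁻ (γ ∷ c) (_ , _ , _ , () , _)

test-lam-sound : ∀ {n} (M : Exp (suc n) tm) (Ls : List (Exp n tm)) →
  test (lam M ∷ Ls) ≅ map (λ M′ → test (M′ ∷ Ls)) (subst (σ₀ []) M)
test-lam-sound M Ls = mk⇔ to from
  where
  to : ∀ {ρ v} → ⟦ test (lam M ∷ Ls) ⟧ ρ v → ⟦ map (λ M′ → test (M′ ∷ Ls)) (subst (σ₀ []) M) ⟧Σ ρ v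
  to (ρ₁ , ρ₂ , q , (_ , β , ⋆≈ , m) , t) with ⋆≈:: β ⋆≈
  ... | refl , β≈⋆
    with ⟦⟧Σ-find (⟦subst⟧⁺ (σ₀ []) M (⟦⟧-resp M (≋-refl _) β≈⋆ m) (SubstEnv-σ₀⁺ [] [] ρ₁ (≋-sym (⊕-identityˡ ρ₁)) (≋-refl ∅)))
  ... | _ , mM , hM = ⟦⟧Σ-map⁺ (λ M′ → test (M′ ∷ Ls)) mM (ρ₁ , ρ₂ , q , hM , t)
  from : ∀ {ρ v} → ⟦ map (λ M′ → test (M′ ∷ Ls)) (subst (σ₀ []) M) ⟧Σ ρ v → ⟦ test (lam M ∷ Ls) ⟧ ρ v
  from h with ⟦⟧Σ-map⁻ (λ M′ → test (M′ ∷ Ls)) (subst (σ₀ []) M) h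
  ... | _ , mM , (ρ₁ , ρ₂ , q , hM , t) with ⟦subst⟧⁻ (σ₀ []) M (⟦⟧Σ-lose mM hM)
  ... | c ∷ ρ′ , hM′ , se with SubstEnv-σ₀⁻ [] c ρ′ se
  ... | r , q′ , p with Prom-0⁻ c p
  ... | refl , r≋∅ =
    ρ₁ , ρ₂ , q , ([] , ⋆ , seq≈ (padˡ []) ,
      ⟦⟧-resp M ([] ∷ ≋-sym (≋-trans (refineˡ q′ r≋∅) (⊕-identityˡ ρ′))) (≈-refl ⋆) hM′) , t

test-tbar-sound : ∀ {n} (Ks Ls : List (Exp n tm)) → test (tbar (test Ks) ∷ Ls) ≅ (test (Ks ++ Ls) ∷ [])
test-tbar-sound Ks Ls = mk⇔ to from
  where
  to : ∀ {ρ v} → ⟦ test (tbar (test Ks) ∷ Ls) ⟧ ρ v → ⟦ test (Ks ++ Ls) ∷ [] ⟧Σ ρ v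
  to (_ , _ , q , (_ , t₁) , t₂) = inj₁ (Tst-++⁺ Ks q t₁ t₂)
  from : ∀ {ρ v} → ⟦ test (Ks ++ Ls) ∷ [] ⟧Σ ρ v → ⟦ test (tbar (test Ks) ∷ Ls) ⟧ ρ v
  from (inj₁ t) with Tst-++⁻ Ks t
  ... | ρ₁ , ρ₂ , q , t₁ , t₂ = ρ₁ , ρ₂ , q , (≈-refl ⋆ , t₁) , t₂

lam-cong : ∀ {n} (M : Exp (suc n) tm) {𝕄} → M ≅ 𝕄 → lam M ≅ map lam 𝕄
lam-cong M {𝕄} M≅ = mk⇔ to from
  where
  to : ∀ {ρ v} → ⟦ lam M ⟧ ρ v → ⟦ map lam 𝕄 ⟧Σ ρ v
  to (b , β , q , m) with ⟦⟧Σ-find (Equivalence.to M≅ m)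
  ... | _ , mM , m′ = ⟦⟧Σ-map⁺ lam mM (b , β , q , m′)
  from : ∀ {ρ v} → ⟦ map lam 𝕄 ⟧Σ ρ v → ⟦ lam M ⟧ ρ v
  from h with ⟦⟧Σ-map⁻ lam 𝕄 h
  ... | _ , mM , (b , β , q , m) = b , β , q , Equivalence.from M≅ (⟦⟧Σ-lose mM m)

appˡ-cong : ∀ {n} (M : Exp n tm) {𝕄} (P : Exp n bg) → M ≅ 𝕄 → app M P ≅ map (λ M′ → app M′ P) 𝕄
appˡ-cong M {𝕄} P M≅ = mk⇔ to from
  where
  to : ∀ {ρ v} → ⟦ app M P ⟧ ρ v → ⟦ map (λ M′ → app M′ P) 𝕄 ⟧Σ ρ v
  to (b , ρ₁ , ρ₂ , q , m , p) with ⟦⟧Σ-find (Equivalence.to M≅ m)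
  ... | _ , mM , m′ = ⟦⟧Σ-map⁺ (λ M′ → app M′ P) mM (b , ρ₁ , ρ₂ , q , m′ , p)
  from : ∀ {ρ v} → ⟦ map (λ M′ → app M′ P) 𝕄 ⟧Σ ρ v → ⟦ app M P ⟧ ρ v
  from h with ⟦⟧Σ-map⁻ (λ M′ → app M′ P) 𝕄 h
  ... | _ , mM , (b , ρ₁ , ρ₂ , q , m , p) = b , ρ₁ , ρ₂ , q , Equivalence.from M≅ (⟦⟧Σ-lose mM m) , p

appʳ-cong : ∀ {n} (M : Exp n tm) (P : Exp n bg) {ℙ} → P ≅ ℙ → app M P ≅ map (app M) ℙ
appʳ-cong M P {ℙ} P≅ = mk⇔ to from
  where
  to : ∀ {ρ v} → ⟦ app M P ⟧ ρ v → ⟦ map (app M) ℙ ⟧Σ ρ v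
  to (b , ρ₁ , ρ₂ , q , m , p) with ⟦⟧Σ-find (Equivalence.to P≅ p)
  ... | _ , mP , p′ = ⟦⟧Σ-map⁺ (app M) mP (b , ρ₁ , ρ₂ , q , m , p′)
  from : ∀ {ρ v} → ⟦ map (app M) ℙ ⟧Σ ρ v → ⟦ app M P ⟧ ρ v
  from h with ⟦⟧Σ-map⁻ (app M) ℙ h
  ... | _ , mP , (b , ρ₁ , ρ₂ , q , m , p) = b , ρ₁ , ρ₂ , q , m , Equivalence.from P≅ (⟦⟧Σ-lose mP p)

tbar-cong : ∀ {n} (V : Exp n ts) {𝕍} → V ≅ 𝕍 → tbar V ≅ map tbar 𝕍
tbar-cong V {𝕍} V≅ = mk⇔ to from
  where
  to : ∀ {ρ v} → ⟦ tbar V ⟧ ρ v → ⟦ map tbar 𝕍 ⟧Σ ρ v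
  to (q , t) with ⟦⟧Σ-find (Equivalence.to V≅ t)
  ... | _ , mV , t′ = ⟦⟧Σ-map⁺ tbar mV (q , t′)
  from : ∀ {ρ v} → ⟦ map tbar 𝕍 ⟧Σ ρ v → ⟦ tbar V ⟧ ρ v
  from h with ⟦⟧Σ-map⁻ tbar 𝕍 h
  ... | _ , mV , (q , t) = q , Equivalence.from V≅ (⟦⟧Σ-lose mV t)

Lin-middle-find : ∀ {n} (Ls₁ Ls₂ : List (Exp n tm)) {L : Exp n tm} {𝕃 ρ βs} → (∀ {ρ β} → ⟦ L ⟧ ρ β → ⟦ 𝕃 ⟧Σ ρ β) →
  Lin (Ls₁ ++ L ∷ Ls₂) ρ βs → ∃ λ L′ → L′ ∈ 𝕃 × Lin (Ls₁ ++ L′ ∷ Ls₂) ρ βs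
Lin-middle-find Ls₁ Ls₂ f l with Lin-++⁻ Ls₁ l
... | _ , _ , _ , _ , refl , q , l₁ , (β , βs₂ , ρc , ρd , refl , q′ , hL , l₂) with ⟦⟧Σ-find (f hL)
... | L′ , mL , hL′ = L′ , mL , Lin-++⁺ Ls₁ q l₁ (β , βs₂ , ρc , ρd , refl , q′ , hL′ , l₂)

Lin-middle-cong : ∀ {n} (Ls₁ Ls₂ : List (Exp n tm)) {L L′ : Exp n tm} {ρ βs} → (∀ {ρ β} → ⟦ L ⟧ ρ β → ⟦ L′ ⟧ ρ β) →
  Lin (Ls₁ ++ L ∷ Ls₂) ρ βs → Lin (Ls₁ ++ L′ ∷ Ls₂) ρ βs
Lin-middle-cong Ls₁ Ls₂ {L′ = L′} f l with Lin-middle-find Ls₁ Ls₂ {𝕃 = L′ ∷ []} (λ h → inj₁ (f h)) l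
... | _ , here refl , l′ = l′
... | _ , there () , _

Tst-middle-find : ∀ {n} (Ls₁ Ls₂ : List (Exp n tm)) {L : Exp n tm} {𝕃 ρ} → (∀ {ρ} → ⟦ L ⟧ ρ ⋆ → ⟦ 𝕃 ⟧Σ ρ ⋆) →
  Tst (Ls₁ ++ L ∷ Ls₂) ρ → ∃ λ L′ → L′ ∈ 𝕃 × Tst (Ls₁ ++ L′ ∷ Ls₂) ρ
Tst-middle-find Ls₁ Ls₂ f t with Tst-++⁻ Ls₁ t
... | _ , _ , q , t₁ , (ρc , ρd , q′ , hL , t₂) with ⟦⟧Σ-find (f hL)
... | L′ , mL , hL′ = L′ , mL , Tst-++⁺ Ls₁ q t₁ (ρc , ρd , q′ , hL′ , t₂)

Tst-middle-cong : ∀ {n} (Ls₁ Ls₂ : List (Exp n tm)) {L L′ : Exp n tm} {ρ} → (∀ {ρ} → ⟦ L ⟧ ρ ⋆ → ⟦ L′ ⟧ ρ ⋆) →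
  Tst (Ls₁ ++ L ∷ Ls₂) ρ → Tst (Ls₁ ++ L′ ∷ Ls₂) ρ
Tst-middle-cong Ls₁ Ls₂ {L′ = L′} f t with Tst-middle-find Ls₁ Ls₂ {𝕃 = L′ ∷ []} (λ h → inj₁ (f h)) t
... | _ , here refl , t′ = t′
... | _ , there () , _

bag-lin-cong : ∀ {n} (Ls₁ Ls₂ N : List (Exp n tm)) L {𝕃} → L ≅ 𝕃 →
  bag (Ls₁ ++ L ∷ Ls₂) N ≅ map (λ L′ → bag (Ls₁ ++ L′ ∷ Ls₂) N) 𝕃
bag-lin-cong Ls₁ Ls₂ N L {𝕃} L≅ = mk⇔ to from
  where
  to : ∀ {ρ v} → ⟦ bag (Ls₁ ++ L ∷ Ls₂) N ⟧ ρ v → ⟦ map (λ L′ → bag (Ls₁ ++ L′ ∷ Ls₂) N) 𝕃 ⟧Σ ρ v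
  to (ρ₁ , ρ₂ , βs , γs , q , l , p , w) with Lin-middle-find Ls₁ Ls₂ (Equivalence.to L≅) l
  ... | _ , mL , l′ = ⟦⟧Σ-map⁺ (λ L′ → bag (Ls₁ ++ L′ ∷ Ls₂) N) mL (ρ₁ , ρ₂ , βs , γs , q , l′ , p , w)
  from : ∀ {ρ v} → ⟦ map (λ L′ → bag (Ls₁ ++ L′ ∷ Ls₂) N) 𝕃 ⟧Σ ρ v → ⟦ bag (Ls₁ ++ L ∷ Ls₂) N ⟧ ρ v
  from h with ⟦⟧Σ-map⁻ (λ L′ → bag (Ls₁ ++ L′ ∷ Ls₂) N) 𝕃 h
  ... | _ , mL , (ρ₁ , ρ₂ , βs , γs , q , l , p , w) =
    ρ₁ , ρ₂ , βs , γs , q , Lin-middle-cong Ls₁ Ls₂ (λ h → Equivalence.from L≅ (⟦⟧Σ-lose mL h)) l , p , w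

test-cong : ∀ {n} (Ls₁ Ls₂ : List (Exp n tm)) L {𝕃} → L ≅ 𝕃 → test (Ls₁ ++ L ∷ Ls₂) ≅ map (λ L′ → test (Ls₁ ++ L′ ∷ Ls₂)) 𝕃
test-cong Ls₁ Ls₂ L {𝕃} L≅ = mk⇔ to from
  where
  to : ∀ {ρ v} → ⟦ test (Ls₁ ++ L ∷ Ls₂) ⟧ ρ v → ⟦ map (λ L′ → test (Ls₁ ++ L′ ∷ Ls₂)) 𝕃 ⟧Σ ρ v
  to t with Tst-middle-find Ls₁ Ls₂ (Equivalence.to L≅) t
  ... | _ , mL , t′ = ⟦⟧Σ-map⁺ (λ L′ → test (Ls₁ ++ L′ ∷ Ls₂)) mL t′
  from : ∀ {ρ v} → ⟦ map (λ L′ → test (Ls₁ ++ L′ ∷ Ls₂)) 𝕃 ⟧Σ ρ v → ⟦ test (Ls₁ ++ L ∷ Ls₂) ⟧ ρ v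
  from h with ⟦⟧Σ-map⁻ (λ L′ → test (Ls₁ ++ L′ ∷ Ls₂)) 𝕃 h
  ... | _ , mL , t = Tst-middle-cong Ls₁ Ls₂ (λ h → Equivalence.from L≅ (⟦⟧Σ-lose mL h)) t

⟦⟧Σ-splice : ∀ {n s} (A₁ A₂ : Sum n s) (e : Exp n s) {𝔼} → e ≅ 𝔼 → ∀ {ρ v} → ⟦ A₁ ++ e ∷ A₂ ⟧Σ ρ v ⇔ ⟦ A₁ ++ 𝔼 ++ A₂ ⟧Σ ρ v
⟦⟧Σ-splice A₁ A₂ e {𝔼} e≅ = mk⇔ to from
  where
  to : ∀ {ρ v} → ⟦ A₁ ++ e ∷ A₂ ⟧Σ ρ v → ⟦ A₁ ++ 𝔼 ++ A₂ ⟧Σ ρ v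
  to h with ⟦⟧Σ-++⁻ A₁ h
  ... | inj₁ h₁ = ⟦⟧Σ-++⁺ˡ h₁
  ... | inj₂ (inj₁ h₂) = ⟦⟧Σ-++⁺ʳ A₁ (⟦⟧Σ-++⁺ˡ (Equivalence.to e≅ h₂))
  ... | inj₂ (inj₂ h₃) = ⟦⟧Σ-++⁺ʳ A₁ (⟦⟧Σ-++⁺ʳ 𝔼 h₃)
  from : ∀ {ρ v} → ⟦ A₁ ++ 𝔼 ++ A₂ ⟧Σ ρ v → ⟦ A₁ ++ e ∷ A₂ ⟧Σ ρ v
  from h with ⟦⟧Σ-++⁻ A₁ h
  ... | inj₁ h₁ = ⟦⟧Σ-++⁺ˡ h₁
  ... | inj₂ h₂ with ⟦⟧Σ-++⁻ 𝔼 h₂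
  ... | inj₁ h₃ = ⟦⟧Σ-++⁺ʳ A₁ (inj₁ (Equivalence.from e≅ h₃))
  ... | inj₂ h₃ = ⟦⟧Σ-++⁺ʳ A₁ (inj₂ h₃)

bag-prom-cong : ∀ {n} (Ls N₁ N₂ : List (Exp n tm)) M {𝕄} → M ≅ 𝕄 → bag Ls (N₁ ++ M ∷ N₂) ≅ (bag Ls (N₁ ++ 𝕄 ++ N₂) ∷ [])
bag-prom-cong Ls N₁ N₂ M M≅ = mk⇔
  (λ { (ρ₁ , ρ₂ , βs , γs , q , l , p , w) → inj₁ (ρ₁ , ρ₂ , βs , γs , q , l , Prom-mono (Equivalence.to splice) γs p , w) })
  (λ { (inj₁ (ρ₁ , ρ₂ , βs , γs , q , l , p , w)) → ρ₁ , ρ₂ , βs , γs , q , l , Prom-mono (Equivalence.from splice) γs p , w })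
  where splice = ⟦⟧Σ-splice N₁ N₂ M M≅

⟶-sound : ∀ {n s} {e : Exp n s} {𝔼} → e ⟶ 𝔼 → e ≅ 𝔼
⟶-sound (beta M Ls N) = beta-sound M Ls N
⟶-sound (tbar-nil V N) = tbar-nil-sound V N
⟶-sound (tbar-cons V L Ls N) = tbar-cons-sound V L Ls N
⟶-sound (test-lam M Ls) = test-lam-sound M Ls
⟶-sound (test-tbar Ks Ls) = test-tbar-sound Ks Ls
⟶-sound (c-lam {M = M} r) = lam-cong M (⟶-sound r)
⟶-sound (c-appₗ {M = M} P r) = appˡ-cong M P (⟶-sound r)
⟶-sound (c-appᵣ M {P} r) = appʳ-cong M P (⟶-sound r)
⟶-sound (c-tbar {V = V} r) = tbar-cong V (⟶-sound r)
⟶-sound (c-bagₗ Ls₁ Ls₂ N {L} r) = bag-lin-cong Ls₁ Ls₂ N L (⟶-sound r)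
⟶-sound (c-bag! Ls N₁ N₂ {M} r) = bag-prom-cong Ls N₁ N₂ M (⟶-sound r)
⟶-sound (c-test Ls₁ Ls₂ {L} r) = test-cong Ls₁ Ls₂ L (⟶-sound r)

⇒-sound : ∀ {n s} {A B : Sum n s} → A ⇒ B → ∀ {ρ v} → ⟦ A ⟧Σ ρ v ⇔ ⟦ B ⟧Σ ρ v
⇒-sound (step A₁ A₂ {e} r) = ⟦⟧Σ-splice A₁ A₂ e (⟶-sound r)
⇒-sound (equal p) = mk⇔ (⟦⟧Σ-~ₛ p) (⟦⟧Σ-~ₛ (~ₛ-sym p))

↠-sound : ∀ {n s} {A B : Sum n s} → A ↠ B → ∀ {ρ v} → ⟦ A ⟧Σ ρ v ⇔ ⟦ B ⟧Σ ρ v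
↠-sound ε = ⇔.refl
↠-sound (r ◅ rs) = ⇔.trans (⇒-sound r) (↠-sound rs)

theorem7p12 : ∀ {n : ℕ} {s : Sort} (A B : Sum n s) → A ↠ B
            → ∀ (ρ : Env n) (v : Val s) → (⟦ A ⟧Σ ρ v ⇔ ⟦ B ⟧Σ ρ v)
theorem7p12 A B r ρ v = ↠-sound r
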